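{- Let $q$ be a prime power, $N\ge 3$, $X$ an $N$-dimensional $\mathbb{F}_q$-vector space, and $P\subseteq\mathcal{G}_q(X,1)$ a point set with $i:=|P|\ge 2$. (1) If $\dim\langle P\rangle=2$ and $i\le q$, then $\delta_q(X,N-1,P) = \dfrac{(q+1-i)(q-1)\,q^{N-2}}{q^N-1}$. (2) If $i\le N-1$ and $\dim\langle P\rangle=i$, then $\delta_q(X,N-1,P) = \dfrac{(q-1)^i\,q^{N-i}}{q^N-1}$.
   Context: $\mathcal{G}_q(X,j)$ is the set of $j$-dimensional subspaces of $X$. A point set is a nonempty $P\subseteq\mathcal{G}_q(X,1)$; $\langle P\rangle=\sum_{L\in P}L$. A subspace $V\le X$ distinguishes $P$ if no element of $P$ is contained in $V$. $\delta_q(X,k,P)$ is the number of $V\in\mathcal{G}_q(X,k)$ distinguishing $P$, divided by $|\mathcal{G}_q(X,k)|$. -}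

module Defs where

open import Data.Nat using (ℕ; zero; suc; _^_)
open import Data.Nat.Primality using (Prime)
open import Data.Fin using (Fin; _≟_; finToFun; funToFin)
open import Data.Fin.Subset using (Subset; ⁅_⁆)
open import Data.Bool using (Bool; true; false; _∧_; _∨_; not)
open import Data.List using (List; []; _∷_; allFin; concatMap; length; filterᵇ)
open import Data.Bool.ListAction using (all; any)
open import Data.Vec using (lookup; tabulate)
open import Data.Product using (Σ; ∃; _×_)
open import Relation.Nullary using (does; ¬_)
open import Relation.Binary.PropositionalEquality using (_≡_)
open import Algebra.Core using (Op₁; Op₂)
open import Algebra.Structures using (IsCommutativeRing)

IsPrimePower : ℕ → Set
IsPrimePower q = Σ ℕ λ p → Σ ℕ λ k → Prime p × q ≡ p ^ suc k

-- A finite field with q elements, with carrier Fin q (every finite field of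
-- order q is isomorphic to one of this form) and propositional equality.
record FiniteField (q : ℕ) : Set where
  field
    _+_ _*_    : Op₂ (Fin q)
    -_         : Op₁ (Fin q)
    0# 1#      : Fin q
    isCommutativeRing : IsCommutativeRing _≡_ _+_ _*_ -_ 0# 1#
    0≢1        : ¬ (0# ≡ 1#)
    inverse    : ∀ x → ¬ (x ≡ 0#) → ∃ λ y → x * y ≡ 1#

allSubsets : ∀ n → List (Subset n)
allSubsets zero    = Data.Vec.[] ∷ []
allSubsets (suc n) = concatMap (λ S → (true Data.Vec.∷ S) ∷ (false Data.Vec.∷ S) ∷ []) (allSubsets n)

-- The geometry of X = F_q^N.  Vectors of X are encoded as elements of
-- Fin (q ^ N) via the bijection finToFun/funToFin with Fin N → Fin q.
-- Subsets of X are Subset (q ^ N).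
module Geometry {q : ℕ} (F : FiniteField q) (N : ℕ) where
  open FiniteField F

  M : ℕ
  M = q ^ N

  Pt : Set
  Pt = Fin M

  coord : Pt → Fin N → Fin q
  coord = finToFun {q} {N}

  allPts : List Pt
  allPts = allFin M

  _==_ : ∀ {n} → Fin n → Fin n → Bool
  x == y = does (x ≟ y)

  zeroPt : Pt
  zeroPt = funToFin {N} {q} (λ _ → 0#)

  addPt : Pt → Pt → Pt
  addPt x y = funToFin {N} {q} (λ j → coord x j + coord y j)

  subPt : Pt → Pt → Pt
  subPt x y = funToFin {N} {q} (λ j → coord x j + (- coord y j))

  scalePt : Fin q → Pt → Pt
  scalePt a x = funToFin {N} {q} (λ j → a * coord x j)

  sumF : ∀ k → (Fin k → Fin q) → Fin q
  sumF zero    f = 0#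
  sumF (suc k) f = f Fin.zero + sumF k (λ i → f (Fin.suc i))

  lincomb : ∀ {k} → (Fin k → Pt) → (Fin k → Fin q) → Pt
  lincomb {k} B c = funToFin {N} {q} (λ j → sumF k (λ i → c i * coord (B i) j))

  mem : Subset M → Pt → Bool
  mem S x = lookup S x

  isSubspaceᵇ : Subset M → Bool
  isSubspaceᵇ S =
    mem S zeroPt
    ∧ all (λ x → all (λ y → not (mem S x ∧ mem S y) ∨ mem S (addPt x y)) allPts) allPts
    ∧ all (λ a → all (λ x → not (mem S x) ∨ mem S (scalePt a x)) allPts) (allFin q)

  indepᵇ : ∀ {k} → (Fin k → Pt) → Bool
  indepᵇ {k} B =
    all (λ c → not (lincomb B (finToFun c) == zeroPt) ∨ (c == funToFin {k} (λ _ → 0#)))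
        (allFin (q ^ k))

  spansᵇ : ∀ {k} → (Fin k → Pt) → Subset M → Bool
  spansᵇ {k} B S =
    all (λ x → not (mem S x) ∨ any (λ c → lincomb B (finToFun c) == x) (allFin (q ^ k))) allPts

  hasDimᵇ : ℕ → Subset M → Bool
  hasDimᵇ k S =
    isSubspaceᵇ S
    ∧ any (λ b → let B = finToFun {M} {k} b in
                 all (λ i → mem S (B i)) (allFin k) ∧ indepᵇ B ∧ spansᵇ B S)
          (allFin (M ^ k))

  numGr : ℕ → ℕ
  numGr k = length (filterᵇ (hasDimᵇ k) (allSubsets M))

  containedᵇ : Subset M → Subset M → Bool
  containedᵇ L V = all (λ x → not (mem L x) ∨ mem V x) allPts

  distinguishesᵇ : Subset M → List (Subset M) → Bool
  distinguishesᵇ V P = all (λ L → not (containedᵇ L V)) P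

  -- numerator of δ_q(X, k, P)
  numDist : ℕ → List (Subset M) → ℕ
  numDist k P = length (filterᵇ (λ V → hasDimᵇ k V ∧ distinguishesᵇ V P) (allSubsets M))

  sumSub : Subset M → Subset M → Subset M
  sumSub A B = tabulate (λ x → any (λ a → mem A a ∧ mem B (subPt x a)) allPts)

  span : List (Subset M) → Subset M
  span []       = ⁅ zeroPt ⁆
  span (L ∷ Ls) = sumSub L (span Ls)

-- A hyperplane of X = F_q^N is the kernel of a nonzero functional a, determined up to the q − 1
-- nonzero scalars, and it contains the point ⟨v⟩ iff a·v = 0. So (q − 1) times the number of
-- hyperplanes distinguishing P is the number of functionals a with a·v_L ≠ 0 for a generator v_L
-- of every L ∈ P; with P empty this gives (q − 1)·|G_q(X, N−1)| = q^N − 1. If the v_L lie in the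
-- span of k independent vectors u, the value map a ↦ (a·u_j)_j is onto F_q^k with all fibres of
-- size q^(N−k), which reduces the count to F_q^k. When the i points are independent (k = i) this
-- asks for all coordinates nonzero: (q − 1)^i. When they span a plane (k = 2) they become i lines
-- through 0 in F_q^2 meeting pairwise only in 0, whose union has 1 + i(q − 1) points, leaving
-- (q + 1 − i)(q − 1).
module Submission where

open import Defs
open import Data.Nat using (ℕ)

module IndicatorSums where

  open import Data.Nat hiding (_≟_)
  open import Data.Nat.Properties hiding (_≟_)
  open import Data.Bool using (Bool; true; false; T; _∧_; not)
  open import Data.Fin using (Fin; zero; suc; combine; _↑ˡ_; _↑ʳ_; _≟_; punchIn; punchOut)
  open import Data.Fin.Properties using (punchInᵢ≢i; punchIn-punchOut; punchOut-injective; injective⇒≤; any?)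
  open import Data.Product using (Σ; _,_)
  open import Data.Empty using (⊥; ⊥-elim)
  open import Data.List using (List; []; _∷_; _++_; concatMap; filterᵇ; length)
  open import Relation.Nullary using (¬_; yes; no; does)
  open import Relation.Nullary.Decidable using (dec-true; dec-false)
  open import Relation.Binary.PropositionalEquality
  open import Function using (_∘_)

  open import Algebra.Properties.Semiring.Sum +-*-semiring public
  open ≡-Reasoning

  𝟙 : Bool → ℕ
  𝟙 true = 1
  𝟙 false = 0

  𝟙≤1 : ∀ b → 𝟙 b ≤ 1
  𝟙≤1 true = s≤s z≤n
  𝟙≤1 false = z≤n

  1≤𝟙 : ∀ {b} → T b → 1 ≤ 𝟙 b
  1≤𝟙 {true} _ = s≤s z≤n

  𝟙-T : ∀ {b} → T b → 𝟙 b ≡ 1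
  𝟙-T {true} _ = refl

  𝟙-¬T : ∀ {b} → ¬ T b → 𝟙 b ≡ 0
  𝟙-¬T {true} f = ⊥-elim (f _)
  𝟙-¬T {false} f = refl

  𝟙-∧ : ∀ a b → 𝟙 (a ∧ b) ≡ 𝟙 a * 𝟙 b
  𝟙-∧ true b = sym (+-identityʳ (𝟙 b))
  𝟙-∧ false b = refl

  𝟙-not+𝟙 : ∀ b → 𝟙 (not b) + 𝟙 b ≡ 1
  𝟙-not+𝟙 true = refl
  𝟙-not+𝟙 false = refl

  𝟙-inclusion-exclusion : ∀ a b → 𝟙 (not (a ∧ b)) + 𝟙 (not a ∧ not b) ≡ 𝟙 (not a) + 𝟙 (not b)
  𝟙-inclusion-exclusion true true = refl
  𝟙-inclusion-exclusion true false = refl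
  𝟙-inclusion-exclusion false true = refl
  𝟙-inclusion-exclusion false false = refl

  𝟙*𝟙-disjoint : ∀ a b → (T a → T b → ⊥) → 𝟙 a * 𝟙 b ≡ 0
  𝟙*𝟙-disjoint true true f = ⊥-elim (f _ _)
  𝟙*𝟙-disjoint true false f = refl
  𝟙*𝟙-disjoint false b f = refl

  ∑-1 : ∀ n → ∑[ i < n ] 1 ≡ n
  ∑-1 zero = refl
  ∑-1 (suc n) = cong suc (∑-1 n)

  ∑-*ˡ : ∀ {n} c (f : Fin n → ℕ) → ∑[ i < n ] (c * f i) ≡ c * ∑[ i < n ] f i
  ∑-*ˡ c f = sym (*-distribˡ-sum c f)

  ∑-*ʳ : ∀ {n} c (f : Fin n → ℕ) → ∑[ i < n ] (f i * c) ≡ ∑[ i < n ] f i * c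
  ∑-*ʳ c f = sym (*-distribʳ-sum c f)

  ∑-combine : ∀ m n (f : Fin (m * n) → ℕ) →
              ∑[ k < m * n ] f k ≡ ∑[ i < m ] ∑[ j < n ] f (combine i j)
  ∑-combine zero n f = refl
  ∑-combine (suc m) n f = trans (∑-++ n (m * n) f)
    (cong (∑[ j < n ] f (j ↑ˡ (m * n)) +_) (∑-combine m n (λ k → f (n ↑ʳ k))))
    where
    ∑-++ : ∀ m n (f : Fin (m + n) → ℕ) →
           ∑[ k < m + n ] f k ≡ ∑[ i < m ] f (i ↑ˡ n) + ∑[ j < n ] f (m ↑ʳ j)
    ∑-++ zero n f = refl
    ∑-++ (suc m) n f = trans (cong (f zero +_) (∑-++ m n (f ∘ suc))) (sym (+-assoc (f zero) _ _))

  ∑-single : ∀ {n} (k : Fin n) (f : Fin n → ℕ) → (∀ i → i ≢ k → f i ≡ 0) → ∑[ i < n ] f i ≡ f k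
  ∑-single {suc n} k f off = begin
    ∑[ i < suc n ] f i                  ≡⟨ sum-remove {i = k} f ⟩
    f k + ∑[ i < n ] f (punchIn k i)    ≡⟨ cong (f k +_) (sum-cong-≗ (λ i → off _ (punchInᵢ≢i k i))) ⟩
    f k + ∑[ i < n ] 0                  ≡⟨ cong (f k +_) (sum-replicate-zero n) ⟩
    f k + 0                             ≡⟨ +-identityʳ (f k) ⟩
    f k                                 ∎

  ∑-pick : ∀ {n} (k : Fin n) (g : Fin n → ℕ) → ∑[ i < n ] (𝟙 (does (k ≟ i)) * g i) ≡ g k
  ∑-pick {n} k g = begin
    ∑[ i < n ] (𝟙 (does (k ≟ i)) * g i) ≡⟨ ∑-single k _ (λ i i≢k → cong (λ b → 𝟙 b * g i) (dec-false (k ≟ i) (i≢k ∘ sym))) ⟩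
    𝟙 (does (k ≟ k)) * g k              ≡⟨ cong (λ b → 𝟙 b * g k) (dec-true (k ≟ k) refl) ⟩
    1 * g k                             ≡⟨ *-identityˡ (g k) ⟩
    g k                                 ∎

  ∑-𝟙-≟ : ∀ {n} (k : Fin n) → ∑[ i < n ] 𝟙 (does (k ≟ i)) ≡ 1
  ∑-𝟙-≟ k = trans (sum-cong-≗ (λ i → sym (*-identityʳ (𝟙 (does (k ≟ i)))))) (∑-pick k (λ _ → 1))

  ∑-𝟙-≢ : ∀ {n} (k : Fin n) → ∑[ i < n ] 𝟙 (not (does (i ≟ k))) ≡ n ∸ 1
  ∑-𝟙-≢ {suc n} k = begin
    ∑[ i < suc n ] 𝟙 (not (does (i ≟ k)))                      ≡⟨ sum-remove {i = k} (λ i → 𝟙 (not (does (i ≟ k)))) ⟩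
    𝟙 (not (does (k ≟ k))) + ∑[ i < n ] 𝟙 (not (does (punchIn k i ≟ k)))
      ≡⟨ cong₂ _+_ (cong (𝟙 ∘ not) (dec-true (k ≟ k) refl))
                   (sum-cong-≗ (λ i → cong (𝟙 ∘ not) (dec-false (punchIn k i ≟ k) (punchInᵢ≢i k i)))) ⟩
    ∑[ i < n ] 1                                                ≡⟨ ∑-1 n ⟩
    n                                                           ∎

  ∑-𝟙≤1 : ∀ {n} (p : Fin n → Bool) (k : Fin n) → (∀ i → T (p i) → i ≡ k) → ∑[ i < n ] 𝟙 (p i) ≤ 1
  ∑-𝟙≤1 p k only-k = ≤-trans (≤-reflexive (∑-single k (𝟙 ∘ p) off)) (𝟙≤1 (p k))
    where
    off : ∀ i → i ≢ k → 𝟙 (p i) ≡ 0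
    off i i≢k = 𝟙-¬T (i≢k ∘ only-k i)

  1≤∑-𝟙 : ∀ {n} (p : Fin n → Bool) (a : Fin n) → T (p a) → 1 ≤ ∑[ i < n ] 𝟙 (p i)
  1≤∑-𝟙 {suc n} p a pa = ≤-trans (1≤𝟙 pa)
    (≤-trans (m≤m+n (𝟙 (p a)) _) (≤-reflexive (sym (sum-remove {i = a} (𝟙 ∘ p)))))

  2≤∑-𝟙 : ∀ {n} (p : Fin n → Bool) (a b : Fin n) → a ≢ b → T (p a) → T (p b) → 2 ≤ ∑[ i < n ] 𝟙 (p i)
  2≤∑-𝟙 {suc n} p a b a≢b pa pb =
    ≤-trans (+-mono-≤ (1≤𝟙 pa) (1≤∑-𝟙 (p ∘ punchIn a) (punchOut a≢b) pb'))
            (≤-reflexive (sym (sum-remove {i = a} (𝟙 ∘ p))))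
    where
    pb' : T (p (punchIn a (punchOut a≢b)))
    pb' = subst (T ∘ p) (sym (punchIn-punchOut a≢b)) pb

  injective⇒surjective : ∀ {m} (f : Fin m → Fin m) → (∀ {x y} → f x ≡ f y → x ≡ y) → ∀ y → Σ (Fin m) λ x → f x ≡ y
  injective⇒surjective f inj y with any? (λ x → f x ≟ y)
  ... | yes hit = hit
  ... | no miss = ⊥-elim (pigeonhole f inj y miss)
    where
    pigeonhole : ∀ {m} (f : Fin m → Fin m) → (∀ {x y} → f x ≡ f y → x ≡ y) → ∀ y → ¬ (Σ (Fin m) λ x → f x ≡ y) → ⊥
    pigeonhole {suc m} f inj y miss = n≮n m (injective⇒≤ {f = g} g-inj)
      where
      g : Fin (suc m) → Fin m
      g x = punchOut {i = y} {j = f x} (λ e → miss (x , sym e))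
      g-inj : ∀ {x x'} → g x ≡ g x' → x ≡ x'
      g-inj {x} {x'} e = inj (punchOut-injective (λ e → miss (x , sym e)) (λ e → miss (x' , sym e)) e)

  ∑ᴸ : ∀ {a} {A : Set a} → List A → (A → ℕ) → ℕ
  ∑ᴸ [] f = 0
  ∑ᴸ (x ∷ xs) f = f x + ∑ᴸ xs f

  ∑ᴸ-cong : ∀ {a} {A : Set a} (xs : List A) {f g : A → ℕ} → (∀ x → f x ≡ g x) → ∑ᴸ xs f ≡ ∑ᴸ xs g
  ∑ᴸ-cong [] e = refl
  ∑ᴸ-cong (x ∷ xs) e = cong₂ _+_ (e x) (∑ᴸ-cong xs e)

  length-filterᵇ : ∀ {a} {A : Set a} (p : A → Bool) (xs : List A) → length (filterᵇ p xs) ≡ ∑ᴸ xs (𝟙 ∘ p)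
  length-filterᵇ p [] = refl
  length-filterᵇ p (x ∷ xs) with p x
  ... | true = cong suc (length-filterᵇ p xs)
  ... | false = length-filterᵇ p xs

  ∑ᴸ-∑ : ∀ {a} {A : Set a} (xs : List A) {n} (f : A → Fin n → ℕ) →
         ∑ᴸ xs (λ x → ∑[ i < n ] f x i) ≡ ∑[ i < n ] ∑ᴸ xs (λ x → f x i)
  ∑ᴸ-∑ [] {n} f = sym (sum-replicate-zero n)
  ∑ᴸ-∑ (x ∷ xs) f = trans (cong (∑[ i < _ ] f x i +_) (∑ᴸ-∑ xs f)) (sym (∑-distrib-+ (f x) _))

  ∑ᴸ-*ʳ : ∀ {a} {A : Set a} (xs : List A) c (f : A → ℕ) → ∑ᴸ xs (λ x → f x * c) ≡ ∑ᴸ xs f * c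
  ∑ᴸ-*ʳ [] c f = refl
  ∑ᴸ-*ʳ (x ∷ xs) c f = trans (cong (f x * c +_) (∑ᴸ-*ʳ xs c f)) (sym (*-distribʳ-+ c (f x) _))

  ∑ᴸ-concatMap : ∀ {a} {A B : Set a} (f : A → List B) (xs : List A) g → ∑ᴸ (concatMap f xs) g ≡ ∑ᴸ xs (λ x → ∑ᴸ (f x) g)
  ∑ᴸ-concatMap f [] g = refl
  ∑ᴸ-concatMap f (x ∷ xs) g = trans (∑ᴸ-++ (f x) (concatMap f xs)) (cong (∑ᴸ (f x) g +_) (∑ᴸ-concatMap f xs g))
    where
    ∑ᴸ-++ : ∀ ys zs → ∑ᴸ (ys ++ zs) g ≡ ∑ᴸ ys g + ∑ᴸ zs g
    ∑ᴸ-++ [] zs = refl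
    ∑ᴸ-++ (y ∷ ys) zs = trans (cong (g y +_) (∑ᴸ-++ ys zs)) (sym (+-assoc (g y) _ _))

module BoolReflection where

  open import Data.Bool using (Bool; true; false; T; _∧_; _∨_; not)
  open import Data.Unit using (tt)
  open import Data.Sum using (_⊎_; inj₁; inj₂)
  open import Data.Product using (Σ; _×_; _,_; proj₁; proj₂)
  open import Data.Empty using (⊥-elim)
  open import Data.Fin using (Fin)
  open import Data.List using (List; []; _∷_; allFin)
  open import Data.List.Relation.Unary.Any using (here; there)
  open import Data.List.Membership.Propositional using (_∈_)
  open import Data.List.Membership.Propositional.Properties using (∈-allFin)
  open import Data.Bool.ListAction using (all; any)
  open import Relation.Nullary using (¬_; Dec; yes; no; does)
  open import Relation.Binary.PropositionalEquality using (_≡_; refl)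

  T-∧ : ∀ {a b} → T (a ∧ b) → T a × T b
  T-∧ {true} {true} _ = tt , tt

  ∧-T : ∀ {a b} → T a → T b → T (a ∧ b)
  ∧-T {true} {true} _ _ = tt

  T-∨ : ∀ {a b} → T (a ∨ b) → T a ⊎ T b
  T-∨ {true} _ = inj₁ tt
  T-∨ {false} {true} _ = inj₂ tt

  ∨-Tˡ : ∀ {a} b → T a → T (a ∨ b)
  ∨-Tˡ {true} b _ = tt

  ∨-Tʳ : ∀ a {b} → T b → T (a ∨ b)
  ∨-Tʳ true _ = tt
  ∨-Tʳ false t = t

  T-not : ∀ {a} → T (not a) → ¬ T a
  T-not {false} _ ()

  not-T : ∀ {a} → ¬ T a → T (not a)
  not-T {true} h = h tt
  not-T {false} h = tt

  T-imp : ∀ {a b} → T (not a ∨ b) → T a → T b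
  T-imp {true} t _ = t

  imp-T : ∀ {a b} → (T a → T b) → T (not a ∨ b)
  imp-T {true} f = f tt
  imp-T {false} f = tt

  T-ext : ∀ {a b} → (T a → T b) → (T b → T a) → a ≡ b
  T-ext {true} {true} f g = refl
  T-ext {true} {false} f g = ⊥-elim (f tt)
  T-ext {false} {true} f g = ⊥-elim (g tt)
  T-ext {false} {false} f g = refl

  T-does : ∀ {p} {P : Set p} (d : Dec P) → T (does d) → P
  T-does (yes p) _ = p

  does-T : ∀ {p} {P : Set p} (d : Dec P) → P → T (does d)
  does-T (yes p) _ = _
  does-T (no ¬p) p = ¬p p

  T-all : ∀ {a} {A : Set a} (p : A → Bool) (xs : List A) → T (all p xs) → ∀ {x} → x ∈ xs → T (p x)
  T-all p (y ∷ xs) t (here refl) = proj₁ (T-∧ t)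
  T-all p (y ∷ xs) t (there m) = T-all p xs (proj₂ (T-∧ {p y} t)) m

  all-T : ∀ {a} {A : Set a} (p : A → Bool) (xs : List A) → (∀ {x} → x ∈ xs → T (p x)) → T (all p xs)
  all-T p [] h = tt
  all-T p (y ∷ xs) h = ∧-T (h (here refl)) (all-T p xs (λ m → h (there m)))

  T-any : ∀ {a} {A : Set a} (p : A → Bool) (xs : List A) → T (any p xs) → Σ A (λ x → T (p x))
  T-any p (y ∷ xs) t with T-∨ {p y} t
  ... | inj₁ t' = y , t'
  ... | inj₂ t' = T-any p xs t'

  any-T : ∀ {a} {A : Set a} (p : A → Bool) (xs : List A) {x} → x ∈ xs → T (p x) → T (any p xs)
  any-T p (y ∷ xs) (here refl) t = ∨-Tˡ _ t
  any-T p (y ∷ xs) (there m) t = ∨-Tʳ (p y) (any-T p xs m t)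

  T-allFin : ∀ {n} (p : Fin n → Bool) → T (all p (allFin n)) → ∀ x → T (p x)
  T-allFin {n} p t x = T-all p (allFin n) t (∈-allFin x)

  allFin-T : ∀ {n} (p : Fin n → Bool) → (∀ x → T (p x)) → T (all p (allFin n))
  allFin-T {n} p h = all-T p (allFin n) (λ {x} _ → h x)

  T-anyFin : ∀ {n} (p : Fin n → Bool) → T (any p (allFin n)) → Σ (Fin n) (λ x → T (p x))
  T-anyFin {n} p t = T-any p (allFin n) t

  anyFin-T : ∀ {n} (p : Fin n → Bool) x → T (p x) → T (any p (allFin n))
  anyFin-T {n} p x t = any-T p (allFin n) (∈-allFin x) t

module LinearAlgebra {q : ℕ} (F : FiniteField q) where
  open import Data.Nat using (ℕ; zero; suc)
  open import Data.Fin using (Fin; zero; suc; _≟_; punchIn)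
  open import Data.Fin.Properties using (punchIn-injective; punchInᵢ≢i; ¬∀⟶∃¬)
  open import Data.Product using (Σ; ∃; _×_; _,_; proj₁; proj₂)
  open import Data.Empty using (⊥-elim)
  open import Data.Bool using (if_then_else_)
  open import Relation.Nullary using (¬_; yes; no; does)
  open import Relation.Binary.PropositionalEquality
  open import Function using (_∘_)
  open import Algebra.Bundles using (CommutativeRing)
  import Algebra.Properties.Semiring.Sum

  open FiniteField F public hiding (_+_; _*_; -_)

  infixl 6 _+_
  infixl 7 _*_
  infix 8 -_
  _+_ : Fin q → Fin q → Fin q
  _+_ = FiniteField._+_ F
  _*_ : Fin q → Fin q → Fin q
  _*_ = FiniteField._*_ F
  -_ : Fin q → Fin q
  -_ = FiniteField.-_ F

  R : CommutativeRing _ _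
  R = record { isCommutativeRing = isCommutativeRing }

  open CommutativeRing R public
    using (+-comm; +-assoc; *-comm; *-assoc; +-identityˡ; +-identityʳ; *-identityˡ; *-identityʳ;
           distribˡ; distribʳ; -‿inverseʳ; -‿inverseˡ; zeroˡ; zeroʳ)
  open import Algebra.Properties.Ring (CommutativeRing.ring R) public
    using (-‿distribˡ-*; -‿distribʳ-*; -‿involutive; -0#≈0#; -‿anti-homo-+)

  module FS = Algebra.Properties.Semiring.Sum (CommutativeRing.semiring R)

  -- Opaque: unfolding the sums would leave many implicit arguments below uninferable.
  opaque
    ∑ᶠ : ∀ n → (Fin n → Fin q) → Fin q
    ∑ᶠ n f = FS.sum f

    ∑ᶠ-cong : ∀ {n} {f g : Fin n → Fin q} → (∀ i → f i ≡ g i) → ∑ᶠ n f ≡ ∑ᶠ n g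
    ∑ᶠ-cong = FS.sum-cong-≗

    ∑ᶠ-0 : ∀ n → ∑ᶠ n (λ _ → 0#) ≡ 0#
    ∑ᶠ-0 = FS.sum-replicate-zero

    ∑ᶠ-+ : ∀ {n} (f g : Fin n → Fin q) → ∑ᶠ n (λ i → f i + g i) ≡ ∑ᶠ n f + ∑ᶠ n g
    ∑ᶠ-+ = FS.∑-distrib-+

    ∑ᶠ-*ˡ : ∀ {n} c (f : Fin n → Fin q) → ∑ᶠ n (λ i → c * f i) ≡ c * ∑ᶠ n f
    ∑ᶠ-*ˡ c f = sym (FS.*-distribˡ-sum c f)

    ∑ᶠ-*ʳ : ∀ {n} c (f : Fin n → Fin q) → ∑ᶠ n (λ i → f i * c) ≡ ∑ᶠ n f * c
    ∑ᶠ-*ʳ c f = sym (FS.*-distribʳ-sum c f)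

    ∑ᶠ-neg : ∀ {n} (f : Fin n → Fin q) → ∑ᶠ n (λ i → - f i) ≡ - ∑ᶠ n f
    ∑ᶠ-neg {zero} f = sym -0#≈0#
    ∑ᶠ-neg {suc n} f = trans (cong (- f zero +_) (∑ᶠ-neg (f ∘ suc)))
      (trans (+-comm (- f zero) _) (sym (-‿anti-homo-+ (f zero) _)))

    ∑ᶠ-swap : ∀ {m n} (f : Fin m → Fin n → Fin q) → ∑ᶠ m (λ i → ∑ᶠ n (f i)) ≡ ∑ᶠ n (λ j → ∑ᶠ m (λ i → f i j))
    ∑ᶠ-swap = FS.∑-comm

    ∑ᶠ-remove : ∀ {n} (k : Fin (suc n)) (f : Fin (suc n) → Fin q) → ∑ᶠ (suc n) f ≡ f k + ∑ᶠ n (f ∘ punchIn k)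
    ∑ᶠ-remove k f = FS.sum-remove {i = k} f

    ∑ᶠ-zero : ∀ (f : Fin 0 → Fin q) → ∑ᶠ 0 f ≡ 0#
    ∑ᶠ-zero f = refl

    ∑ᶠ-suc : ∀ {n} (f : Fin (suc n) → Fin q) → ∑ᶠ (suc n) f ≡ f zero + ∑ᶠ n (f ∘ suc)
    ∑ᶠ-suc f = refl

  ∑ᶠ-*0 : ∀ {n} (f : Fin n → Fin q) → ∑ᶠ n (λ i → f i * 0#) ≡ 0#
  ∑ᶠ-*0 {n} f = trans (∑ᶠ-cong (λ i → zeroʳ (f i))) (∑ᶠ-0 n)

  ∑ᶠ-single : ∀ {n} (k : Fin n) (f : Fin n → Fin q) → (∀ i → ¬ i ≡ k → f i ≡ 0#) → ∑ᶠ n f ≡ f k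
  ∑ᶠ-single {suc n} k f h = trans (∑ᶠ-remove k f)
    (trans (cong (f k +_) (trans (∑ᶠ-cong (λ i → h (punchIn k i) (punchInᵢ≢i k i))) (∑ᶠ-0 n))) (+-identityʳ (f k)))

  δ : ∀ {n} → Fin n → Fin n → Fin q
  δ i j = if does (i ≟ j) then 1# else 0#

  δ-diag : ∀ {n} (i : Fin n) → δ i i ≡ 1#
  δ-diag i with i ≟ i
  ... | yes _ = refl
  ... | no ne = ⊥-elim (ne refl)

  δ-off : ∀ {n} {i j : Fin n} → ¬ i ≡ j → δ i j ≡ 0#
  δ-off {i = i} {j} ne with i ≟ j
  ... | yes e = ⊥-elim (ne e)
  ... | no _ = refl

  δ-sym : ∀ {n} (i j : Fin n) → δ i j ≡ δ j i
  δ-sym i j with i ≟ j | j ≟ i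
  ... | yes _ | yes _ = refl
  ... | yes e | no ne = ⊥-elim (ne (sym e))
  ... | no ne | yes e = ⊥-elim (ne (sym e))
  ... | no _ | no _ = refl

  δ-punchIn : ∀ {n} (m : Fin (suc n)) i i' → δ (punchIn m i') (punchIn m i) ≡ δ i' i
  δ-punchIn m i i' with i' ≟ i
  ... | yes refl = δ-diag (punchIn m i)
  ... | no ne = δ-off (λ e → ne (punchIn-injective m i' i e))

  δ-pivot-punchIn : ∀ {n} (m : Fin (suc n)) i → δ m (punchIn m i) ≡ 0#
  δ-pivot-punchIn m i = δ-off (λ e → punchInᵢ≢i m i (sym e))

  ∑ᶠ-δʳ : ∀ {n} (k : Fin n) (f : Fin n → Fin q) → ∑ᶠ n (λ i → f i * δ i k) ≡ f k
  ∑ᶠ-δʳ k f = trans (∑ᶠ-single k _ (λ i ne → trans (cong (f i *_) (δ-off ne)) (zeroʳ (f i))))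
                    (trans (cong (f k *_) (δ-diag k)) (*-identityʳ (f k)))

  ∑ᶠ-δʳ' : ∀ {n} (k : Fin n) (f : Fin n → Fin q) → ∑ᶠ n (λ i → f i * δ k i) ≡ f k
  ∑ᶠ-δʳ' k f = trans (∑ᶠ-cong (λ i → cong (f i *_) (δ-sym k i))) (∑ᶠ-δʳ k f)

  ∑ᶠ-δˡ : ∀ {n} (k : Fin n) (f : Fin n → Fin q) → ∑ᶠ n (λ i → δ k i * f i) ≡ f k
  ∑ᶠ-δˡ k f = trans (∑ᶠ-cong (λ i → *-comm (δ k i) (f i))) (∑ᶠ-δʳ' k f)

  x-y+y≡x : ∀ a b → a + - b + b ≡ a
  x-y+y≡x a b = trans (+-assoc a (- b) b) (trans (cong (a +_) (-‿inverseˡ b)) (+-identityʳ a))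

  x+y≡0⇒x≡-y : ∀ {a b} → a + b ≡ 0# → a ≡ - b
  x+y≡0⇒x≡-y {a} {b} e = begin
    a             ≡⟨ sym (+-identityʳ a) ⟩
    a + 0#        ≡⟨ cong (a +_) (sym (-‿inverseʳ b)) ⟩
    a + (b + - b) ≡⟨ sym (+-assoc a b (- b)) ⟩
    a + b + - b   ≡⟨ cong (_+ - b) e ⟩
    0# + - b      ≡⟨ +-identityˡ (- b) ⟩
    - b           ∎
    where open ≡-Reasoning

  x-y≡0⇒x≡y : ∀ {a b} → a + - b ≡ 0# → a ≡ b
  x-y≡0⇒x≡y {a} {b} e = trans (x+y≡0⇒x≡-y e) (-‿involutive b)

  x*y≡1⇒x*t≡0⇒t≡0 : ∀ {c y t} → c * y ≡ 1# → c * t ≡ 0# → t ≡ 0#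
  x*y≡1⇒x*t≡0⇒t≡0 {c} {y} {t} cy ct = begin
    t           ≡⟨ sym (*-identityˡ t) ⟩
    1# * t      ≡⟨ cong (_* t) (sym cy) ⟩
    c * y * t   ≡⟨ cong (_* t) (*-comm c y) ⟩
    y * c * t   ≡⟨ *-assoc y c t ⟩
    y * (c * t) ≡⟨ cong (y *_) ct ⟩
    y * 0#      ≡⟨ zeroʳ y ⟩
    0#          ∎
    where open ≡-Reasoning

  *-≢0 : ∀ {a b} → ¬ a ≡ 0# → ¬ b ≡ 0# → ¬ a * b ≡ 0#
  *-≢0 {a} {b} na nb e = nb (x*y≡1⇒x*t≡0⇒t≡0 (proj₂ (inverse a na)) e)

  y*x≡1⇒x*a+b≡0⇒a≡-y*b : ∀ {x y a b} → y * x ≡ 1# → x * a + b ≡ 0# → a ≡ - (y * b)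
  y*x≡1⇒x*a+b≡0⇒a≡-y*b {x} {y} {a} {b} yx≡1 e = begin
    a           ≡⟨ sym (*-identityˡ a) ⟩
    1# * a      ≡⟨ cong (_* a) (sym yx≡1) ⟩
    y * x * a   ≡⟨ *-assoc y x a ⟩
    y * (x * a) ≡⟨ cong (y *_) (x+y≡0⇒x≡-y e) ⟩
    y * - b     ≡⟨ sym (-‿distribʳ-* y b) ⟩
    - (y * b)   ∎
    where open ≡-Reasoning

  y*x≡1⇒x*a+x'*b≡0⇒a≡-y*x'*b : ∀ {x x' y a b} → y * x ≡ 1# → x * a + x' * b ≡ 0# → a ≡ - (y * x') * b
  y*x≡1⇒x*a+x'*b≡0⇒a≡-y*x'*b {x} {x'} {y} yx≡1 e =
    trans (y*x≡1⇒x*a+b≡0⇒a≡-y*b yx≡1 e) (trans (cong -_ (sym (*-assoc y x' _))) (-‿distribˡ-* (y * x') _))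

  𝔽^ : ℕ → Set
  𝔽^ n = Fin n → Fin q

  dot : ∀ {n} → 𝔽^ n → 𝔽^ n → Fin q
  dot {n} a x = ∑ᶠ n (λ j → a j * x j)

  comb : ∀ {n k} → (Fin k → 𝔽^ n) → 𝔽^ k → 𝔽^ n
  comb {n} {k} B c j = ∑ᶠ k (λ i → c i * B i j)

  unitVec : ∀ {n} → Fin n → 𝔽^ n
  unitVec k j = δ k j

  cons : ∀ {a} {A : Set a} {k} → A → (Fin k → A) → Fin (suc k) → A
  cons a c zero = a
  cons a c (suc i) = c i

  pair : ∀ {n} → 𝔽^ n → 𝔽^ n → Fin 2 → 𝔽^ n
  pair u v zero = u
  pair u v (suc _) = v

  nonzero-entry : ∀ {n} (r : 𝔽^ n) → ¬ (∀ j → r j ≡ 0#) → ∃ λ j → ¬ r j ≡ 0#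
  nonzero-entry {n} r h = ¬∀⟶∃¬ n (λ j → r j ≡ 0#) (λ j → r j ≟ 0#) h

  dot-comm : ∀ {n} (a x : 𝔽^ n) → dot a x ≡ dot x a
  dot-comm a x = ∑ᶠ-cong (λ j → *-comm (a j) (x j))

  dot-cong : ∀ {n} {a a' x x' : 𝔽^ n} → (∀ j → a j ≡ a' j) → (∀ j → x j ≡ x' j) → dot a x ≡ dot a' x'
  dot-cong ea ex = ∑ᶠ-cong (λ j → cong₂ _*_ (ea j) (ex j))

  dot-+ˡ : ∀ {n} (a b x : 𝔽^ n) → dot (λ j → a j + b j) x ≡ dot a x + dot b x
  dot-+ˡ a b x = trans (∑ᶠ-cong (λ j → distribʳ (x j) (a j) (b j))) (∑ᶠ-+ (λ j → a j * x j) (λ j → b j * x j))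

  dot-*ˡ : ∀ {n} c (a x : 𝔽^ n) → dot (λ j → c * a j) x ≡ c * dot a x
  dot-*ˡ c a x = trans (∑ᶠ-cong (λ j → *-assoc c (a j) (x j))) (∑ᶠ-*ˡ c (λ j → a j * x j))

  dot-negˡ : ∀ {n} (a x : 𝔽^ n) → dot (λ j → - a j) x ≡ - dot a x
  dot-negˡ a x = trans (∑ᶠ-cong (λ j → sym (-‿distribˡ-* (a j) (x j)))) (∑ᶠ-neg (λ j → a j * x j))

  dot-0ˡ : ∀ {n} (x : 𝔽^ n) → dot (λ _ → 0#) x ≡ 0#
  dot-0ˡ {n} x = trans (∑ᶠ-cong (λ j → zeroˡ (x j))) (∑ᶠ-0 n)

  dot-unitVecˡ : ∀ {n} (k : Fin n) (x : 𝔽^ n) → dot (unitVec k) x ≡ x k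
  dot-unitVecˡ k x = ∑ᶠ-δˡ k x

  dot-+ʳ : ∀ {n} (a x y : 𝔽^ n) → dot a (λ j → x j + y j) ≡ dot a x + dot a y
  dot-+ʳ a x y = trans (dot-comm a _) (trans (dot-+ˡ x y a) (cong₂ _+_ (dot-comm x a) (dot-comm y a)))

  dot-*ʳ : ∀ {n} c (a x : 𝔽^ n) → dot a (λ j → c * x j) ≡ c * dot a x
  dot-*ʳ c a x = trans (dot-comm a _) (trans (dot-*ˡ c x a) (cong (c *_) (dot-comm x a)))

  dot-negʳ : ∀ {n} (a x : 𝔽^ n) → dot a (λ j → - x j) ≡ - dot a x
  dot-negʳ a x = trans (dot-comm a _) (trans (dot-negˡ x a) (cong -_ (dot-comm x a)))

  dot-0ʳ : ∀ {n} (a : 𝔽^ n) → dot a (λ _ → 0#) ≡ 0#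
  dot-0ʳ a = trans (dot-comm a _) (dot-0ˡ a)

  dot-unitVecʳ : ∀ {n} (a : 𝔽^ n) (k : Fin n) → dot a (unitVec k) ≡ a k
  dot-unitVecʳ a k = trans (dot-comm a (unitVec k)) (dot-unitVecˡ k a)

  dot-subscaleʳ : ∀ {n} (a u v : 𝔽^ n) c → dot a (λ l → u l + - (c * v l)) ≡ dot a u + - (c * dot a v)
  dot-subscaleʳ a u v c = trans (dot-+ʳ a u (λ l → - (c * v l)))
    (cong (dot a u +_) (trans (dot-negʳ a (λ l → c * v l)) (cong -_ (dot-*ʳ c a v))))

  dot-combˡ : ∀ {n k} (B : Fin k → 𝔽^ n) (c : 𝔽^ k) (x : 𝔽^ n) →
              dot (comb B c) x ≡ ∑ᶠ k (λ i → c i * dot (B i) x)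
  dot-combˡ {n} {k} B c x =
    trans (∑ᶠ-cong (λ j → sym (∑ᶠ-*ʳ (x j) (λ i → c i * B i j))))
    (trans (∑ᶠ-swap (λ j i → c i * B i j * x j))
           (∑ᶠ-cong (λ i → trans (∑ᶠ-cong (λ j → *-assoc (c i) (B i j) (x j))) (∑ᶠ-*ˡ (c i) (λ j → B i j * x j)))))

  dot-combʳ : ∀ {n k} (B : Fin k → 𝔽^ n) (c : 𝔽^ k) (x : 𝔽^ n) →
              dot x (comb B c) ≡ ∑ᶠ k (λ i → c i * dot x (B i))
  dot-combʳ B c x = trans (dot-comm x (comb B c)) (trans (dot-combˡ B c x) (∑ᶠ-cong (λ i → cong (c i *_) (dot-comm (B i) x))))

  dot-subcombˡ : ∀ {n k} (u : 𝔽^ n) (C : Fin k → 𝔽^ n) (w : 𝔽^ k) (v : 𝔽^ n) →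
    dot (λ j → u j + - comb C w j) v ≡ dot u v + - ∑ᶠ k (λ i → w i * dot (C i) v)
  dot-subcombˡ u C w v = trans (dot-+ˡ u (λ j → - comb C w j) v)
    (cong (dot u v +_) (trans (dot-negˡ (comb C w) v) (cong -_ (dot-combˡ C w v))))

  dot-subcombʳ : ∀ {n k} (a u : 𝔽^ n) (C : Fin k → 𝔽^ n) (w : 𝔽^ k) →
    dot a (λ j → u j + - comb C w j) ≡ dot a u + - ∑ᶠ k (λ i → w i * dot a (C i))
  dot-subcombʳ a u C w = trans (dot-comm a _) (trans (dot-subcombˡ u C w a)
    (cong₂ (λ s t → s + - t) (dot-comm u a) (∑ᶠ-cong (λ i → cong (w i *_) (dot-comm (C i) a)))))

  comb-cong : ∀ {n k} (B : Fin k → 𝔽^ n) {c c' : 𝔽^ k} → (∀ i → c i ≡ c' i) → ∀ j → comb B c j ≡ comb B c' j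
  comb-cong B e j = ∑ᶠ-cong (λ i → cong (_* B _ j) (e i))

  comb-zero : ∀ {n} (B : Fin 0 → 𝔽^ n) (c : 𝔽^ 0) j → comb B c j ≡ 0#
  comb-zero B c j = ∑ᶠ-zero _

  comb-suc : ∀ {n k} (B : Fin (suc k) → 𝔽^ n) (c : 𝔽^ (suc k)) j →
             comb B c j ≡ c zero * B zero j + comb (B ∘ suc) (c ∘ suc) j
  comb-suc B c j = ∑ᶠ-suc (λ i → c i * B i j)

  comb-cons : ∀ {n k} (B : Fin (suc k) → 𝔽^ n) a (c : 𝔽^ k) j →
              comb B (cons a c) j ≡ a * B zero j + comb (B ∘ suc) c j
  comb-cons B a c j = comb-suc B (cons a c) j

  comb-unitVec : ∀ {n k} (B : Fin k → 𝔽^ n) l j → comb B (unitVec l) j ≡ B l j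
  comb-unitVec B l j = ∑ᶠ-δˡ l (λ i → B i j)

  comb-single : ∀ {n} (b : Fin 1 → 𝔽^ n) (c : 𝔽^ 1) j → comb b c j ≡ c zero * b zero j
  comb-single b c j = trans (comb-suc b c j) (trans (cong (c zero * b zero j +_) (comb-zero (b ∘ suc) (c ∘ suc) j)) (+-identityʳ _))

  comb-pair : ∀ {n} (u v : 𝔽^ n) (c : 𝔽^ 2) j → comb (pair u v) c j ≡ c zero * u j + c (suc zero) * v j
  comb-pair u v c j = trans (comb-suc (pair u v) c j) (cong (c zero * u j +_) (trans (comb-suc (pair u v ∘ suc) (c ∘ suc) j)
    (trans (cong (c (suc zero) * v j +_) (comb-zero (λ (_ : Fin 0) → v) (λ i → c (suc (suc i))) j)) (+-identityʳ _))))

  comb-0 : ∀ {n k} (B : Fin k → 𝔽^ n) j → comb B (λ _ → 0#) j ≡ 0#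
  comb-0 {n} {k} B j = trans (∑ᶠ-cong (λ i → zeroˡ (B i j))) (∑ᶠ-0 k)

  comb-sub : ∀ {n k} (B : Fin k → 𝔽^ n) (x y : 𝔽^ k) j → comb B (λ i → x i + - y i) j ≡ comb B x j + - comb B y j
  comb-sub B x y j = trans (∑ᶠ-cong (λ i → trans (distribʳ (B i j) (x i) (- y i)) (cong (x i * B i j +_) (sym (-‿distribˡ-* (y i) (B i j))))))
    (trans (∑ᶠ-+ (λ i → x i * B i j) (λ i → - (y i * B i j))) (cong (comb B x j +_) (∑ᶠ-neg (λ i → y i * B i j))))

  comb-neg-* : ∀ {n k} (B : Fin k → 𝔽^ n) y (c : 𝔽^ k) j → - (y * comb B c j) ≡ comb B (λ i → - (y * c i)) j
  comb-neg-* {k = k} B y c j = begin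
    - (y * comb B c j)                     ≡⟨ cong -_ (sym (∑ᶠ-*ˡ y (λ i → c i * B i j))) ⟩
    - ∑ᶠ k (λ i → y * (c i * B i j))       ≡⟨ sym (∑ᶠ-neg _) ⟩
    ∑ᶠ k (λ i → - (y * (c i * B i j)))     ≡⟨ ∑ᶠ-cong (λ i → trans (cong -_ (sym (*-assoc y (c i) (B i j)))) (-‿distribˡ-* _ _)) ⟩
    comb B (λ i → - (y * c i)) j           ∎
    where open ≡-Reasoning

  comb-lin : ∀ {n k} (B : Fin k → 𝔽^ n) s t (x y : 𝔽^ k) j → comb B (λ m → s * x m + t * y m) j ≡ s * comb B x j + t * comb B y j
  comb-lin B s t x y j = trans (∑ᶠ-cong (λ m → trans (distribʳ (B m j) (s * x m) (t * y m)) (cong₂ _+_ (*-assoc s (x m) (B m j)) (*-assoc t (y m) (B m j)))))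
    (trans (∑ᶠ-+ (λ m → s * (x m * B m j)) (λ m → t * (y m * B m j))) (cong₂ _+_ (∑ᶠ-*ˡ s (λ m → x m * B m j)) (∑ᶠ-*ˡ t (λ m → y m * B m j))))

  Independent : ∀ {n k} → (Fin k → 𝔽^ n) → Set
  Independent {n} {k} B = ∀ c → (∀ j → comb B c j ≡ 0#) → ∀ i → c i ≡ 0#

  DualBasis : ∀ {n k} → (Fin k → 𝔽^ n) → (Fin k → 𝔽^ n) → Set
  DualBasis {n} {k} B d = ∀ m i → dot (d m) (B i) ≡ δ m i

  independent-tail : ∀ {n k} (B : Fin (suc k) → 𝔽^ n) → Independent B → Independent (B ∘ suc)
  independent-tail B indB c h i = indB (cons 0# c)
    (λ j → trans (comb-cons B 0# c j) (trans (cong (_+ comb (B ∘ suc) c j) (zeroˡ (B zero j))) (trans (+-identityˡ _) (h j)))) (suc i)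

  nonzero-independent : ∀ {n} (v : 𝔽^ n) → ¬ (∀ j → v j ≡ 0#) → Independent (λ (_ : Fin 1) → v)
  nonzero-independent v nz c h zero = x*y≡1⇒x*t≡0⇒t≡0 (proj₂ (inverse (v m) (proj₂ mw))) (trans (*-comm (v m) (c zero))
     (trans (sym (+-identityʳ _)) (trans (cong (c zero * v m +_) (sym (comb-zero (λ (_ : Fin 0) → v) (c ∘ suc) m))) (trans (sym (comb-suc (λ _ → v) c m)) (h m)))))
    where
    mw = nonzero-entry v nz
    m = proj₁ mw

  -- The residual r = B₀ − ∑ₘ (d'ₘ · B₀) B'ₘ is nonzero by independence and killed by every d'ₘ.
  -- Rescaling a coordinate functional at a nonzero entry of r and correcting along d' gives d₀.
  separating-functional : ∀ {n k} (B : Fin (suc k) → 𝔽^ n) → Independent B →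
    (d' : Fin k → 𝔽^ n) → DualBasis (B ∘ suc) d' →
    Σ (𝔽^ n) λ d₀ → dot d₀ (B zero) ≡ 1# × (∀ i → dot d₀ (B (suc i)) ≡ 0#)
  separating-functional {n} {k} B indB d' dd' = d₀ , d₀-B₀ , d₀-B'
    where
    B₀ = B zero
    B' = B ∘ suc
    x : 𝔽^ k
    x m = dot (d' m) B₀
    r : 𝔽^ n
    r j = B₀ j + - comb B' x j
    r≢0 : ¬ (∀ j → r j ≡ 0#)
    r≢0 h = 0≢1 (sym (indB (cons 1# (λ m → - x m)) hc zero))
      where
      hc : ∀ j → comb B (cons 1# (λ m → - x m)) j ≡ 0#
      hc j = trans (comb-cons B 1# (λ m → - x m) j) (trans (cong₂ _+_ (*-identityˡ (B₀ j))
                     (trans (∑ᶠ-cong (λ i → sym (-‿distribˡ-* (x i) (B' i j)))) (∑ᶠ-neg (λ i → x i * B' i j))))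
                   (h j))
    jr = nonzero-entry r r≢0
    j₀ = proj₁ jr
    yr = inverse (r j₀) (proj₂ jr)
    y = proj₁ yr
    e : 𝔽^ n
    e l = y * unitVec j₀ l
    dot-e : ∀ v → dot e v ≡ y * v j₀
    dot-e v = trans (dot-*ˡ y (unitVec j₀) v) (cong (y *_) (dot-unitVecˡ j₀ v))
    z : 𝔽^ k
    z m = dot e (B' m)
    d₀ : 𝔽^ n
    d₀ l = e l + - comb d' z l
    d₀-B' : ∀ i → dot d₀ (B' i) ≡ 0#
    d₀-B' i = trans (dot-subcombˡ e d' z (B' i)) (trans (cong (λ t → z i + - t) (trans (∑ᶠ-cong (λ m → cong (z m *_) (dd' m i))) (∑ᶠ-δʳ i z))) (-‿inverseʳ (z i)))
    d'-r : ∀ m → dot (d' m) r ≡ 0#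
    d'-r m = trans (dot-subcombʳ (d' m) B₀ B' x) (trans (cong (λ t → x m + - t) (trans (∑ᶠ-cong (λ l → cong (x l *_) (dd' m l))) (∑ᶠ-δʳ' m x))) (-‿inverseʳ (x m)))
    d₀-r : dot d₀ r ≡ 1#
    d₀-r = trans (dot-subcombˡ e d' z r)
      (trans (cong₂ (λ s t → s + - t) (trans (dot-e r) (trans (*-comm y (r j₀)) (proj₂ yr)))
                    (trans (∑ᶠ-cong (λ m → cong (z m *_) (d'-r m))) (∑ᶠ-*0 z)))
        (trans (cong (1# +_) -0#≈0#) (+-identityʳ 1#)))
    d₀-B₀ : dot d₀ B₀ ≡ 1#
    d₀-B₀ = trans (dot-cong {a = d₀} (λ _ → refl) (λ j → sym (x-y+y≡x (B₀ j) (comb B' x j))))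
      (trans (dot-+ʳ d₀ r (comb B' x))
        (trans (cong₂ _+_ d₀-r (trans (dot-combʳ B' x d₀) (trans (∑ᶠ-cong (λ m → cong (x m *_) (d₀-B' m))) (∑ᶠ-*0 x))))
          (+-identityʳ 1#)))

  dualBasis : ∀ {n k} (B : Fin k → 𝔽^ n) → Independent B → Σ (Fin k → 𝔽^ n) (DualBasis B)
  dualBasis {n} {zero} B indB = (λ ()) , (λ ())
  dualBasis {n} {suc k} B indB = d , dd
    where
    B₀ = B zero
    B' = B ∘ suc
    IH = dualBasis B' (independent-tail B indB)
    d' = proj₁ IH
    dd' = proj₂ IH
    sep = separating-functional B indB d' dd'
    d₀ = proj₁ sep
    d₀-B₀ = proj₁ (proj₂ sep)
    d₀-B' = proj₂ (proj₂ sep)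
    x : 𝔽^ k
    x m = dot (d' m) B₀
    d : Fin (suc k) → 𝔽^ n
    d zero = d₀
    d (suc m) l = d' m l + - (x m * d₀ l)
    dot-d-suc : ∀ m v → dot (d (suc m)) v ≡ dot (d' m) v + - (x m * dot d₀ v)
    dot-d-suc m v = trans (dot-+ˡ (d' m) (λ l → - (x m * d₀ l)) v)
      (cong (dot (d' m) v +_) (trans (dot-negˡ (λ l → x m * d₀ l) v) (cong -_ (dot-*ˡ (x m) d₀ v))))
    dd : DualBasis B d
    dd zero zero = d₀-B₀
    dd zero (suc i) = d₀-B' i
    dd (suc m) zero = trans (dot-d-suc m B₀) (trans (cong (λ t → x m + - t) (trans (cong (x m *_) d₀-B₀) (*-identityʳ (x m)))) (-‿inverseʳ (x m)))
    dd (suc m) (suc i) = trans (dot-d-suc m (B' i)) (trans (cong₂ (λ s t → s + - t) (dd' m i) (trans (cong (x m *_) (d₀-B' i)) (zeroʳ (x m))))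
       (trans (cong (δ m i +_) -0#≈0#) (+-identityʳ _)))

module Counting {q : ℕ} (F : FiniteField q) where
  open import Data.Nat using (ℕ; zero; suc; _^_; _∸_; _+_; _*_; _≤_; _<_; z≤n; s≤s; NonZero; >-nonZero)
  open import Data.Nat.Properties as ℕP using ()
  open import Data.Nat.Tactic.RingSolver using (solve-∀)
  open import Data.Fin using (Fin; zero; suc; _≟_; finToFun; funToFin; combine)
  open import Data.Fin.Properties using (remQuot-combine; funToFin-finToFin; finToFun-funToFin; injective⇒≤; any?; all?; suc-injective)
  open import Data.Product using (Σ; _×_; _,_; proj₁; proj₂)
  open import Data.Sum using (_⊎_; inj₁; inj₂)
  open import Data.Empty using (⊥-elim)
  open import Data.Bool using (Bool; true; T; _∧_; not)
  open import Data.Bool.Properties using (not-involutive; ∧-identityʳ)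
  open import Relation.Nullary using (¬_; yes; no; does; _×-dec_; ¬?)
  open import Relation.Binary.PropositionalEquality
  open import Function using (_∘_)

  open IndicatorSums
  open BoolReflection
  open LinearAlgebra F renaming (_+_ to _+ᶠ_; _*_ to _*ᶠ_; -_ to -ᶠ_)

  funToFin-cong : ∀ {n} {u v : 𝔽^ n} → (∀ j → u j ≡ v j) → funToFin u ≡ funToFin v
  funToFin-cong {zero} e = refl
  funToFin-cong {suc n} e = cong₂ combine (e zero) (funToFin-cong (e ∘ suc))

  module Coordinates (n : ℕ) where
    Code : Set
    Code = Fin (q ^ n)

    dec : Code → 𝔽^ n
    dec = finToFun {q} {n}

    enc : 𝔽^ n → Code
    enc = funToFin {n} {q}

    dec-enc : ∀ (v : 𝔽^ n) j → dec (enc v) j ≡ v j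
    dec-enc v j = finToFun-funToFin v j

    enc-dec : (x : Code) → enc (dec x) ≡ x
    enc-dec x = funToFin-finToFin {n} {q} x

    enc-cong : {u v : 𝔽^ n} → (∀ j → u j ≡ v j) → enc u ≡ enc v
    enc-cong = funToFin-cong

    dec-inj : {x y : Code} → (∀ j → dec x j ≡ dec y j) → x ≡ y
    dec-inj {x} {y} e = trans (sym (enc-dec x)) (trans (enc-cong e) (enc-dec y))

    enc≡⇒≗dec : {v : 𝔽^ n} {c : Code} → enc v ≡ c → ∀ j → v j ≡ dec c j
    enc≡⇒≗dec {v = v} refl j = sym (dec-enc v j)

    ≗dec⇒enc≡ : {v : 𝔽^ n} {c : Code} → (∀ j → v j ≡ dec c j) → enc v ≡ c
    ≗dec⇒enc≡ {c = c} e = trans (enc-cong e) (enc-dec c)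

    0ᶜ : Code
    0ᶜ = enc (λ _ → 0#)

    dec-0ᶜ : ∀ j → dec 0ᶜ j ≡ 0#
    dec-0ᶜ j = dec-enc (λ _ → 0#) j

    dec≗0⇒≡0ᶜ : ∀ {x} → (∀ j → dec x j ≡ 0#) → x ≡ 0ᶜ
    dec≗0⇒≡0ᶜ x≗0 = dec-inj (λ j → trans (x≗0 j) (sym (dec-0ᶜ j)))

  dec-combine : ∀ k (a : Fin q) (b : Fin (q ^ k)) i → Coordinates.dec (suc k) (combine a b) i ≡ cons a (Coordinates.dec k b) i
  dec-combine k a b zero = cong proj₁ (remQuot-combine {q} {q ^ k} a b)
  dec-combine k a b (suc i) = cong (λ t → Coordinates.dec k (proj₂ t) i) (remQuot-combine {q} {q ^ k} a b)

  isNonzero : Fin q → Bool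
  isNonzero a = not (does (a ≟ 0#))

  allNonzero : ∀ {k} → 𝔽^ k → Bool
  allNonzero {zero} v = true
  allNonzero {suc k} v = isNonzero (v zero) ∧ allNonzero (v ∘ suc)

  allNonzero-cong : ∀ {k} {u v : 𝔽^ k} → (∀ i → u i ≡ v i) → allNonzero u ≡ allNonzero v
  allNonzero-cong {zero} e = refl
  allNonzero-cong {suc k} e = cong₂ _∧_ (cong isNonzero (e zero)) (allNonzero-cong (e ∘ suc))

  ¬allNonzero⇒zero-entry : ∀ {k} (v : 𝔽^ k) → ¬ T (allNonzero v) → Σ (Fin k) λ l → v l ≡ 0#
  ¬allNonzero⇒zero-entry {zero} v h = ⊥-elim (h _)
  ¬allNonzero⇒zero-entry {suc k} v h with v zero ≟ 0#
  ... | yes z = zero , z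
  ... | no _ = let w = ¬allNonzero⇒zero-entry (v ∘ suc) h in suc (proj₁ w) , proj₂ w

  zero-head⇒¬allNonzero : ∀ {k} (v : 𝔽^ (suc k)) → v zero ≡ 0# → ¬ T (allNonzero v)
  zero-head⇒¬allNonzero v z t = T-not (proj₁ (T-∧ t)) (does-T (v zero ≟ 0#) z)

  count-allNonzero : ∀ k → ∑[ c < q ^ k ] 𝟙 (allNonzero (Coordinates.dec k c)) ≡ (q ∸ 1) ^ k
  count-allNonzero zero = refl
  count-allNonzero (suc k) = begin
    ∑[ c < q ^ suc k ] 𝟙 (allNonzero (dec (suc k) c))
      ≡⟨ ∑-combine q (q ^ k) _ ⟩
    ∑[ a < q ] ∑[ b < q ^ k ] 𝟙 (allNonzero (dec (suc k) (combine a b)))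
      ≡⟨ sum-cong-≗ (λ a → sum-cong-≗ (λ b → trans (cong 𝟙 (allNonzero-cong (dec-combine k a b))) (𝟙-∧ (isNonzero a) _))) ⟩
    ∑[ a < q ] ∑[ b < q ^ k ] (𝟙 (isNonzero a) * 𝟙 (allNonzero (dec k b)))
      ≡⟨ sum-cong-≗ (λ a → trans (∑-*ˡ (𝟙 (isNonzero a)) (λ b → 𝟙 (allNonzero (dec k b)))) (cong (𝟙 (isNonzero a) *_) (count-allNonzero k))) ⟩
    ∑[ a < q ] (𝟙 (isNonzero a) * (q ∸ 1) ^ k)
      ≡⟨ ∑-*ʳ ((q ∸ 1) ^ k) (λ a → 𝟙 (isNonzero a)) ⟩
    ∑[ a < q ] 𝟙 (isNonzero a) * (q ∸ 1) ^ k
      ≡⟨ cong (_* (q ∸ 1) ^ k) (∑-𝟙-≢ 0#) ⟩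
    (q ∸ 1) ^ suc k ∎
    where
    open ≡-Reasoning
    open Coordinates using (dec)

  q≥2 : 2 ≤ q
  q≥2 = injective⇒≤ {f = f} inj
    where
    f : Fin 2 → Fin q
    f zero = 0#
    f (suc zero) = 1#
    inj : ∀ {x y} → f x ≡ f y → x ≡ y
    inj {zero} {zero} e = refl
    inj {zero} {suc zero} e = ⊥-elim (0≢1 e)
    inj {suc zero} {zero} e = ⊥-elim (0≢1 (sym e))
    inj {suc zero} {suc zero} e = refl

  instance
    q-nonZero : NonZero q
    q-nonZero = >-nonZero (ℕP.≤-trans (s≤s z≤n) q≥2)

  q≡1+[q∸1] : q ≡ 1 + (q ∸ 1)
  q≡1+[q∸1] = sym (ℕP.m+[n∸m]≡n (ℕP.≤-trans (s≤s z≤n) q≥2))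

  1≤q^ : ∀ n → 1 ≤ q ^ n
  1≤q^ zero = s≤s z≤n
  1≤q^ (suc n) = ℕP.*-mono-≤ (ℕP.≤-trans (s≤s z≤n) q≥2) (1≤q^ n)

  -- Translation by a preimage built from the dual basis d maps the kernel onto each fibre.
  module UniformFibres {n k : ℕ} (B : Fin k → 𝔽^ n) (d : Fin k → 𝔽^ n) (dd : DualBasis B d) where
    module N = Coordinates n
    module K = Coordinates k
    open N using (dec; dec-enc; dec-inj)
    open K using (enc; 0ᶜ)

    values : 𝔽^ n → 𝔽^ k
    values a i = dot a (B i)

    valueCode : N.Code → K.Code
    valueCode x = enc (values (dec x))

    kernelSize : ℕ
    kernelSize = ∑[ x < q ^ n ] 𝟙 (does (valueCode x ≟ 0ᶜ))

    fibre-size : ∀ c → ∑[ x < q ^ n ] 𝟙 (does (valueCode x ≟ c)) ≡ kernelSize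
    fibre-size c = trans (∑-permute (λ x → 𝟙 (does (valueCode x ≟ c))) (permutation τ τ' ττ' τ'τ)) (sum-cong-≗ shift)
      where
      open import Data.Fin.Permutation using (permutation)
      s : 𝔽^ n
      s = comb d (K.dec c)
      values-s : ∀ i → dot s (B i) ≡ K.dec c i
      values-s i = trans (dot-combˡ d (K.dec c) (B i)) (trans (∑ᶠ-cong (λ m → cong (K.dec c m *ᶠ_) (dd m i))) (∑ᶠ-δʳ i (K.dec c)))
      τ τ' : N.Code → N.Code
      τ x = N.enc (λ j → dec x j +ᶠ s j)
      τ' x = N.enc (λ j → dec x j +ᶠ -ᶠ s j)
      ττ' : ∀ x → τ (τ' x) ≡ x
      ττ' x = dec-inj (λ j → trans (dec-enc _ j) (trans (cong (_+ᶠ s j) (dec-enc _ j)) (x-y+y≡x (dec x j) (s j))))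
      τ'τ : ∀ x → τ' (τ x) ≡ x
      τ'τ x = dec-inj (λ j → trans (dec-enc _ j) (trans (cong (_+ᶠ -ᶠ s j) (dec-enc _ j))
                (trans (+-assoc (dec x j) (s j) (-ᶠ s j)) (trans (cong (dec x j +ᶠ_) (-‿inverseʳ (s j))) (+-identityʳ _)))))
      values-τ : ∀ x i → values (dec (τ x)) i ≡ values (dec x) i +ᶠ K.dec c i
      values-τ x i = trans (dot-cong (dec-enc (λ j → dec x j +ᶠ s j)) (λ _ → refl))
        (trans (dot-+ˡ (dec x) s (B i)) (cong (values (dec x) i +ᶠ_) (values-s i)))
      x+y≡y⇒x≡0 : ∀ a b → a +ᶠ b ≡ b → a ≡ 0#
      x+y≡y⇒x≡0 a b e = trans (sym (trans (+-assoc a b (-ᶠ b)) (trans (cong (a +ᶠ_) (-‿inverseʳ b)) (+-identityʳ a))))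
                          (trans (cong (_+ᶠ -ᶠ b) e) (-‿inverseʳ b))
      shift : ∀ x → 𝟙 (does (valueCode (τ x) ≟ c)) ≡ 𝟙 (does (valueCode x ≟ 0ᶜ))
      shift x = cong 𝟙 (T-ext
        (λ t → does-T (valueCode x ≟ 0ᶜ) (K.≗dec⇒enc≡ (λ i → trans (x+y≡y⇒x≡0 _ _ (trans (sym (values-τ x i)) (K.enc≡⇒≗dec (T-does (valueCode (τ x) ≟ c) t) i))) (sym (K.dec-0ᶜ i)))))
        (λ t → does-T (valueCode (τ x) ≟ c) (K.≗dec⇒enc≡ (λ i → trans (values-τ x i)
           (trans (cong (_+ᶠ K.dec c i) (trans (K.enc≡⇒≗dec (T-does (valueCode x ≟ 0ᶜ) t) i) (K.dec-0ᶜ i))) (+-identityˡ _))))))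

    ∑-via-values : ∀ (g : K.Code → ℕ) → ∑[ x < q ^ n ] g (valueCode x) ≡ kernelSize * ∑[ c < q ^ k ] g c
    ∑-via-values g = begin
      ∑[ x < q ^ n ] g (valueCode x)
        ≡⟨ sum-cong-≗ (λ x → sym (∑-pick (valueCode x) g)) ⟩
      ∑[ x < q ^ n ] ∑[ c < q ^ k ] (𝟙 (does (valueCode x ≟ c)) * g c)
        ≡⟨ ∑-comm (λ x c → 𝟙 (does (valueCode x ≟ c)) * g c) ⟩
      ∑[ c < q ^ k ] ∑[ x < q ^ n ] (𝟙 (does (valueCode x ≟ c)) * g c)
        ≡⟨ sum-cong-≗ (λ c → trans (∑-*ʳ (g c) (λ x → 𝟙 (does (valueCode x ≟ c)))) (cong (_* g c) (fibre-size c))) ⟩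
      ∑[ c < q ^ k ] (kernelSize * g c)
        ≡⟨ ∑-*ˡ kernelSize g ⟩
      kernelSize * ∑[ c < q ^ k ] g c ∎
      where open ≡-Reasoning

    kernelSize*q^k≡q^n : kernelSize * q ^ k ≡ q ^ n
    kernelSize*q^k≡q^n = trans (cong (kernelSize *_) (sym (∑-1 (q ^ k)))) (trans (sym (∑-via-values (λ _ → 1))) (∑-1 (q ^ n)))

    kernelSize≡q^[n∸k] : k ≤ n → kernelSize ≡ q ^ (n ∸ k)
    kernelSize≡q^[n∸k] k≤n = ℕP.*-cancelʳ-≡ kernelSize (q ^ (n ∸ k)) (q ^ k) {{>-nonZero (1≤q^ k)}}
      (trans kernelSize*q^k≡q^n (trans (cong (q ^_) (sym (ℕP.m∸n+n≡m k≤n))) (ℕP.^-distribˡ-+-* q (n ∸ k) k)))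

  module Kernel {n k : ℕ} (B : Fin k → 𝔽^ n) (indB : Independent B) where
    open UniformFibres B (proj₁ (dualBasis B indB)) (proj₂ (dualBasis B indB)) public
    open Coordinates n using (dec; enc; dec-enc; dec≗0⇒≡0ᶜ)

    InKernel : Coordinates.Code n → Set
    InKernel x = valueCode x ≡ Coordinates.0ᶜ k

    InKernel⇒orthogonal : ∀ x → InKernel x → ∀ i → dot (dec x) (B i) ≡ 0#
    InKernel⇒orthogonal x e i = trans (Coordinates.enc≡⇒≗dec k e i) (Coordinates.dec-0ᶜ k i)

    orthogonal⇒InKernel : ∀ a → (∀ i → dot a (B i) ≡ 0#) → InKernel (enc a)
    orthogonal⇒InKernel a h = Coordinates.≗dec⇒enc≡ k (λ i → trans (dot-cong (dec-enc a) (λ _ → refl)) (trans (h i) (sym (Coordinates.dec-0ᶜ k i))))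

    nontrivial-kernel : k < n → Σ (𝔽^ n) λ a → (¬ (∀ j → a j ≡ 0#)) × (∀ i → dot a (B i) ≡ 0#)
    nontrivial-kernel k<n with any? (λ x → (valueCode x ≟ Coordinates.0ᶜ k) ×-dec ¬? (x ≟ Coordinates.0ᶜ n))
    ... | yes (x , kx , x≢0) = dec x , (x≢0 ∘ dec≗0⇒≡0ᶜ) , InKernel⇒orthogonal x kx
    ... | no none = ⊥-elim (ℕP.<⇒≱ (ℕP.^-monoʳ-< q q≥2 k<n) q^n≤q^k)
      where
      only-0ᶜ : ∀ x → T (does (valueCode x ≟ Coordinates.0ᶜ k)) → x ≡ Coordinates.0ᶜ n
      only-0ᶜ x t with x ≟ Coordinates.0ᶜ n
      ... | yes x≡0 = x≡0
      ... | no x≢0 = ⊥-elim (none (x , T-does (valueCode x ≟ _) t , x≢0))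
      q^n≤q^k : q ^ n ≤ q ^ k
      q^n≤q^k = ℕP.≤-trans (ℕP.≤-reflexive (sym kernelSize*q^k≡q^n))
        (ℕP.≤-trans (ℕP.*-monoˡ-≤ (q ^ k) (∑-𝟙≤1 _ (Coordinates.0ᶜ n) only-0ᶜ)) (ℕP.≤-reflexive (ℕP.+-identityʳ (q ^ k))))

    trivial-kernel : n ≤ k → ∀ a → (∀ i → dot a (B i) ≡ 0#) → ∀ j → a j ≡ 0#
    trivial-kernel n≤k a h j with all? (λ j → a j ≟ 0#)
    ... | yes a≗0 = a≗0 j
    ... | no a≢0 = ⊥-elim (ℕP.<⇒≱ q^n<2q^n 2q^n≤q^n)
      where
      enc-a≢0 : ¬ enc a ≡ Coordinates.0ᶜ n
      enc-a≢0 e = a≢0 (λ j → trans (sym (dec-enc a j)) (trans (cong (λ z → dec z j) e) (Coordinates.dec-0ᶜ n j)))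
      2≤kernelSize : 2 ≤ kernelSize
      2≤kernelSize = 2≤∑-𝟙 (λ x → does (valueCode x ≟ Coordinates.0ᶜ k)) (enc a) (Coordinates.0ᶜ n) enc-a≢0
              (does-T (valueCode (enc a) ≟ _) (orthogonal⇒InKernel a h))
              (does-T (valueCode (Coordinates.0ᶜ n) ≟ _) (orthogonal⇒InKernel (λ _ → 0#) (λ i → dot-0ˡ (B i))))
      q^n<2q^n : q ^ n < 2 * q ^ n
      q^n<2q^n = ℕP.<-≤-trans (ℕP.m<m+n (q ^ n) (1≤q^ n)) (ℕP.≤-reflexive (cong (q ^ n +_) (sym (ℕP.+-identityʳ (q ^ n)))))
      2q^n≤q^n : 2 * q ^ n ≤ q ^ n
      2q^n≤q^n = ℕP.≤-trans (ℕP.*-monoʳ-≤ 2 (ℕP.^-monoʳ-≤ q n≤k))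
             (ℕP.≤-trans (ℕP.*-monoˡ-≤ (q ^ k) 2≤kernelSize) (ℕP.≤-reflexive kernelSize*q^k≡q^n))

  module _ {n k : ℕ} (B : Fin k → 𝔽^ n) where
    private
      module N = Coordinates n
      module K = Coordinates k

    independent-or-dependent : Independent B ⊎ Σ (𝔽^ k) λ c → (∀ j → comb B c j ≡ 0#) × ¬ (∀ i → c i ≡ 0#)
    independent-or-dependent with any? (λ c → (N.enc (comb B (K.dec c)) ≟ N.0ᶜ) ×-dec ¬? (c ≟ K.0ᶜ))
    ... | yes (c , Bc≡0 , c≢0) = inj₂ (K.dec c , (λ j → trans (N.enc≡⇒≗dec Bc≡0 j) (N.dec-0ᶜ j)) , c≢0 ∘ K.dec≗0⇒≡0ᶜ)
    ... | no none = inj₁ independent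
      where
      independent : Independent B
      independent c Bc≡0 i with K.enc c ≟ K.0ᶜ
      ... | yes c≡0 = trans (sym (K.dec-enc c i)) (trans (cong (λ z → K.dec z i) c≡0) (K.dec-0ᶜ i))
      ... | no c≢0 = ⊥-elim (none (K.enc c , N.≗dec⇒enc≡ (λ j → trans (comb-cong B (K.dec-enc c) j) (trans (Bc≡0 j) (sym (N.dec-0ᶜ j)))) , c≢0))

  module Plane = Coordinates 2

  onLine : 𝔽^ 2 → Plane.Code → Bool
  onLine u c = not (isNonzero (dot u (Plane.dec c)))

  line-size : ∀ (w : 𝔽^ 2) → ¬ (∀ j → w j ≡ 0#) → ∑[ c < q ^ 2 ] 𝟙 (onLine w c) ≡ q
  line-size w w≢0 = begin
    ∑[ c < q ^ 2 ] 𝟙 (onLine w c)                           ≡⟨ sum-cong-≗ on-line⇔InKernel ⟩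
    kernelSize                                              ≡⟨ kernelSize≡q^[n∸k] (s≤s z≤n) ⟩
    q * 1                                                   ≡⟨ ℕP.*-identityʳ q ⟩
    q                                                       ∎
    where
    open ≡-Reasoning
    open Kernel (λ (_ : Fin 1) → w) (nonzero-independent w w≢0)
    on-line⇔InKernel : ∀ c → 𝟙 (onLine w c) ≡ 𝟙 (does (valueCode c ≟ Coordinates.0ᶜ 1))
    on-line⇔InKernel c = cong 𝟙 (trans (not-involutive _) (T-ext
      (λ t → does-T (valueCode c ≟ _) (subst InKernel (Plane.enc-dec c)
               (orthogonal⇒InKernel (Plane.dec c) (λ _ → trans (dot-comm (Plane.dec c) w) (T-does (dot w (Plane.dec c) ≟ 0#) t)))))
      (λ t → does-T (dot w (Plane.dec c) ≟ 0#) (trans (dot-comm w (Plane.dec c)) (InKernel⇒orthogonal c (T-does (valueCode c ≟ _) t) zero)))))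

  independent-lines-meet-at-0 : ∀ (u v c : 𝔽^ 2) → Independent (pair u v) → dot u c ≡ 0# → dot v c ≡ 0# → ∀ j → c j ≡ 0#
  independent-lines-meet-at-0 u v c ind uc≡0 vc≡0 = Kernel.trivial-kernel (pair u v) ind ℕP.≤-refl c orthogonal
    where
    orthogonal : ∀ m → dot c (pair u v m) ≡ 0#
    orthogonal zero = trans (dot-comm c u) uc≡0
    orthogonal (suc _) = trans (dot-comm c v) vc≡0

  onSomeLine : ∀ {i} → (Fin i → 𝔽^ 2) → Plane.Code → Bool
  onSomeLine w c = not (allNonzero (λ l → dot (w l) (Plane.dec c)))

  count-onLine-and-onSomeLine : ∀ i (w : Fin (suc (suc i)) → 𝔽^ 2) → (∀ l l' → l ≢ l' → Independent (pair (w l) (w l'))) →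
    ∑[ c < q ^ 2 ] 𝟙 (onLine (w zero) c ∧ onSomeLine (w ∘ suc) c) ≡ 1
  count-onLine-and-onSomeLine i w ind = trans (∑-single Plane.0ᶜ (λ c → 𝟙 (onLine (w zero) c ∧ onSomeLine (w ∘ suc) c)) off-0)
    (𝟙-T (∧-T (not-T (λ t → T-not t (does-T (dot (w zero) (Plane.dec Plane.0ᶜ) ≟ 0#) (w·0≡0 zero))))
              (not-T (zero-head⇒¬allNonzero (λ l → dot (w (suc l)) (Plane.dec Plane.0ᶜ)) (w·0≡0 (suc zero))))))
    where
    w·0≡0 : ∀ l → dot (w l) (Plane.dec Plane.0ᶜ) ≡ 0#
    w·0≡0 l = trans (dot-cong {a = w l} (λ _ → refl) Plane.dec-0ᶜ) (dot-0ʳ (w l))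
    off-0 : ∀ c → c ≢ Plane.0ᶜ → 𝟙 (onLine (w zero) c ∧ onSomeLine (w ∘ suc) c) ≡ 0
    off-0 c c≢0 = 𝟙-¬T on-both
      where
      on-both : ¬ T (onLine (w zero) c ∧ onSomeLine (w ∘ suc) c)
      on-both t = c≢0 (Plane.dec≗0⇒≡0ᶜ (independent-lines-meet-at-0 (w zero) (w (suc l)) (Plane.dec c) (ind zero (suc l) (λ ())) on-w₀ (proj₂ zero-entry)))
        where
        on-w₀ : dot (w zero) (Plane.dec c) ≡ 0#
        on-w₀ = T-does (dot (w zero) (Plane.dec c) ≟ 0#) (subst T (not-involutive _) (proj₁ (T-∧ {onLine (w zero) c} t)))
        zero-entry = ¬allNonzero⇒zero-entry (λ l → dot (w (suc l)) (Plane.dec c)) (T-not (proj₂ (T-∧ {onLine (w zero) c} t)))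
        l = proj₁ zero-entry

  -- Inclusion–exclusion: each line w_l^⊥ has q points and any two of them meet only in 0.
  count-onSomeLine : ∀ i (w : Fin (suc i) → 𝔽^ 2) → (∀ l → ¬ (∀ j → w l j ≡ 0#)) →
    (∀ l l' → l ≢ l' → Independent (pair (w l) (w l'))) →
    ∑[ c < q ^ 2 ] 𝟙 (onSomeLine w c) ≡ 1 + suc i * (q ∸ 1)
  count-onSomeLine zero w w≢0 ind = begin
    ∑[ c < q ^ 2 ] 𝟙 (onSomeLine w c)      ≡⟨ sum-cong-≗ {q ^ 2} (λ c → cong (𝟙 ∘ not) (∧-identityʳ _)) ⟩
    ∑[ c < q ^ 2 ] 𝟙 (onLine (w zero) c)   ≡⟨ line-size (w zero) (w≢0 zero) ⟩
    q                                      ≡⟨ q≡1+[q∸1] ⟩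
    1 + (q ∸ 1)                            ≡⟨ cong suc (sym (ℕP.+-identityʳ (q ∸ 1))) ⟩
    1 + 1 * (q ∸ 1)                        ∎
    where open ≡-Reasoning
  count-onSomeLine (suc i) w w≢0 ind = ℕP.+-cancelʳ-≡ 1 _ _ (begin
    ∑[ c < q ^ 2 ] 𝟙 (onSomeLine w c) + 1
      ≡⟨ cong (∑[ c < q ^ 2 ] 𝟙 (onSomeLine w c) +_) (sym (count-onLine-and-onSomeLine i w ind)) ⟩
    ∑[ c < q ^ 2 ] 𝟙 (onSomeLine w c) + ∑[ c < q ^ 2 ] 𝟙 (onLine (w zero) c ∧ onSomeLine (w ∘ suc) c)
      ≡⟨ sym (∑-distrib-+ (λ c → 𝟙 (onSomeLine w c)) _) ⟩
    ∑[ c < q ^ 2 ] (𝟙 (onSomeLine w c) + 𝟙 (onLine (w zero) c ∧ onSomeLine (w ∘ suc) c))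
      ≡⟨ sum-cong-≗ (λ c → 𝟙-inclusion-exclusion (isNonzero (dot (w zero) (Plane.dec c))) (allNonzero (λ l → dot (w (suc l)) (Plane.dec c)))) ⟩
    ∑[ c < q ^ 2 ] (𝟙 (onLine (w zero) c) + 𝟙 (onSomeLine (w ∘ suc) c))
      ≡⟨ ∑-distrib-+ (λ c → 𝟙 (onLine (w zero) c)) _ ⟩
    ∑[ c < q ^ 2 ] 𝟙 (onLine (w zero) c) + ∑[ c < q ^ 2 ] 𝟙 (onSomeLine (w ∘ suc) c)
      ≡⟨ cong₂ _+_ (trans (line-size (w zero) (w≢0 zero)) q≡1+[q∸1])
                   (count-onSomeLine i (w ∘ suc) (w≢0 ∘ suc) (λ l l' ne → ind (suc l) (suc l') (ne ∘ suc-injective))) ⟩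
    1 + (q ∸ 1) + (1 + suc i * (q ∸ 1))
      ≡⟨ regroup (q ∸ 1) i ⟩
    1 + suc (suc i) * (q ∸ 1) + 1 ∎)
    where
    open ≡-Reasoning
    regroup : ∀ x y → 1 + x + (1 + (1 + y) * x) ≡ 1 + (2 + y) * x + 1
    regroup = solve-∀

  count-allNonzero-plane : ∀ i (w : Fin (suc i) → 𝔽^ 2) → (∀ l → ¬ (∀ j → w l j ≡ 0#)) →
    (∀ l l' → l ≢ l' → Independent (pair (w l) (w l'))) → suc i ≤ q →
    ∑[ c < q ^ 2 ] 𝟙 (allNonzero (λ l → dot (w l) (Plane.dec c))) ≡ (q + 1 ∸ suc i) * (q ∸ 1)
  count-allNonzero-plane i w w≢0 ind i<q = complement q (suc i) G i<q (begin
    1 + suc i * (q ∸ 1) + G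
      ≡⟨ cong (_+ G) (sym (count-onSomeLine i w w≢0 ind)) ⟩
    ∑[ c < q ^ 2 ] 𝟙 (onSomeLine w c) + G
      ≡⟨ sym (∑-distrib-+ (λ c → 𝟙 (onSomeLine w c)) (λ c → 𝟙 (allNonzero (λ l → dot (w l) (Plane.dec c))))) ⟩
    ∑[ c < q ^ 2 ] (𝟙 (onSomeLine w c) + 𝟙 (allNonzero (λ l → dot (w l) (Plane.dec c))))
      ≡⟨ sum-cong-≗ (λ c → 𝟙-not+𝟙 (allNonzero (λ l → dot (w l) (Plane.dec c)))) ⟩
    ∑[ c < q ^ 2 ] 1
      ≡⟨ ∑-1 (q ^ 2) ⟩
    q ^ 2 ∎)
    where
    open ≡-Reasoning
    G = ∑[ c < q ^ 2 ] 𝟙 (allNonzero (λ l → dot (w l) (Plane.dec c)))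
    complement : ∀ q m G → m ≤ q → 1 + m * (q ∸ 1) + G ≡ q ^ 2 → G ≡ (q + 1 ∸ m) * (q ∸ 1)
    complement (suc r) m G m≤q e = trans (ℕP.+-cancelˡ-≡ (1 + m * r) G (suc s * r) (trans e q²-split)) (cong (_* r) (sym q+1-m≡1+s))
      where
      s = suc r ∸ m
      m+s≡q : m + s ≡ suc r
      m+s≡q = ℕP.m+[n∸m]≡n m≤q
      q²-split : suc r ^ 2 ≡ 1 + m * r + suc s * r
      q²-split = begin
        suc r ^ 2             ≡⟨ square r ⟩
        suc r + r * suc r     ≡⟨ cong (λ t → suc r + r * t) (sym m+s≡q) ⟩
        suc r + r * (m + s)   ≡⟨ expand r m s ⟩
        1 + m * r + suc s * r ∎
        where
        square : ∀ x → (1 + x) * ((1 + x) * 1) ≡ 1 + x + x * (1 + x)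
        square = solve-∀
        expand : ∀ x y z → 1 + x + x * (y + z) ≡ 1 + y * x + (1 + z) * x
        expand = solve-∀
      q+1-m≡1+s : suc r + 1 ∸ m ≡ suc s
      q+1-m≡1+s = trans (cong (λ t → t + 1 ∸ m) (sym m+s≡q)) (trans (cong (_∸ m) (ℕP.+-assoc m s 1)) (trans (ℕP.m+n∸m≡n m (s + 1)) (ℕP.+-comm s 1)))

module SubsetEnumeration where
  open import Data.Nat using (ℕ; zero; suc; _*_)
  open import Data.Nat.Properties using (+-identityʳ)
  open import Data.Bool using (Bool; true; false)
  open import Data.Bool.Properties using () renaming (_≟_ to _≟ᴮ_)
  open import Data.Vec using (Vec; []; _∷_)
  open import Data.Vec.Properties using (≡-dec)
  open import Data.List using ([]; _∷_)
  open import Relation.Nullary using (does)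
  open import Relation.Binary.Definitions using (DecidableEquality)
  open import Relation.Binary.PropositionalEquality using (_≡_; trans)
  open IndicatorSums

  _≟ˢ_ : ∀ {n} → DecidableEquality (Vec Bool n)
  _≟ˢ_ = ≡-dec _≟ᴮ_

  ∑ᴸ-allSubsets-pick : ∀ n (S : Vec Bool n) (g : Vec Bool n → ℕ) → ∑ᴸ (allSubsets n) (λ V → 𝟙 (does (S ≟ˢ V)) * g V) ≡ g S
  ∑ᴸ-allSubsets-pick zero [] g = trans (+-identityʳ _) (+-identityʳ (g []))
  ∑ᴸ-allSubsets-pick (suc n) (b ∷ S) g =
    trans (∑ᴸ-concatMap _ (allSubsets n) _) (trans (∑ᴸ-cong (allSubsets n) (pick-head b)) (∑ᴸ-allSubsets-pick n S (λ V → g (b ∷ V))))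
    where
    pick-head : ∀ b V → ∑ᴸ ((true ∷ V) ∷ (false ∷ V) ∷ []) (λ W → 𝟙 (does ((b ∷ S) ≟ˢ W)) * g W) ≡ 𝟙 (does (S ≟ˢ V)) * g (b ∷ V)
    pick-head true V = +-identityʳ _
    pick-head false V = +-identityʳ _

module Subspaces {q : ℕ} (F : FiniteField q) (N : ℕ) where
  open import Data.Nat using (zero; suc; _^_)
  open import Data.Fin using (Fin; zero; suc; _≟_; finToFun; funToFin)
  open import Data.Fin.Properties using (finToFun-funToFin; all?)
  open import Data.Fin.Subset using (Subset; ⁅_⁆)
  open import Data.Product using (Σ; _×_; _,_; proj₁; proj₂)
  open import Data.Sum using (inj₁; inj₂)
  open import Data.Empty using (⊥-elim)
  open import Data.Unit using (tt)
  open import Data.Bool using (false; T; _∧_; _∨_; not)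
  open import Data.List using (List; []; _∷_; allFin; length; lookup)
  open import Data.List.Relation.Unary.All using (All; []; _∷_)
  open import Data.List.Relation.Unary.Unique.Propositional using (Unique)
  open import Data.List.Relation.Unary.AllPairs using ([]; _∷_)
  open import Data.Bool.ListAction using (all; any)
  open import Data.Vec using (tabulate) renaming (lookup to lookupᵛ)
  open import Data.Vec.Properties using (lookup∘tabulate; tabulate∘lookup; tabulate-cong; lookup-replicate)
  open import Relation.Nullary using (¬_; yes; no; does)
  open import Relation.Binary.PropositionalEquality
  open import Function using (_∘_)

  open IndicatorSums using (injective⇒surjective)
  open BoolReflection
  open LinearAlgebra F renaming (_+_ to _+ᶠ_; _*_ to _*ᶠ_; -_ to -ᶠ_)
  open Counting F
  open Geometry F N

  module C = Coordinates N

  coord-add : ∀ x y j → coord (addPt x y) j ≡ coord x j +ᶠ coord y j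
  coord-add x y j = C.dec-enc (λ j → coord x j +ᶠ coord y j) j

  coord-sub : ∀ x y j → coord (subPt x y) j ≡ coord x j +ᶠ -ᶠ coord y j
  coord-sub x y j = C.dec-enc (λ j → coord x j +ᶠ -ᶠ coord y j) j

  coord-scale : ∀ a x j → coord (scalePt a x) j ≡ a *ᶠ coord x j
  coord-scale a x j = C.dec-enc (λ j → a *ᶠ coord x j) j

  coord-zero : ∀ j → coord zeroPt j ≡ 0#
  coord-zero j = C.dec-enc (λ _ → 0#) j

  sumF≡∑ᶠ : ∀ k f → sumF k f ≡ ∑ᶠ k f
  sumF≡∑ᶠ zero f = sym (∑ᶠ-zero f)
  sumF≡∑ᶠ (suc k) f = trans (cong (f zero +ᶠ_) (sumF≡∑ᶠ k (f ∘ suc))) (sym (∑ᶠ-suc f))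

  pt≡enc : ∀ x (v : 𝔽^ N) → (∀ l → coord x l ≡ v l) → x ≡ C.enc v
  pt≡enc x v e = trans (sym (C.enc-dec x)) (C.enc-cong e)

  memS : Subset M → Pt → Set
  memS S x = T (mem S x)

  mem-subst : ∀ S {x y} → x ≡ y → memS S x → memS S y
  mem-subst S refl m = m

  subset-ext : ∀ (S S' : Subset M) → (∀ x → mem S x ≡ mem S' x) → S ≡ S'
  subset-ext S S' e = trans (sym (tabulate∘lookup S)) (trans (tabulate-cong e) (tabulate∘lookup S'))

  record IsSubspace (S : Subset M) : Set where
    field
      ∋0 : memS S zeroPt
      +-closed : ∀ x y → memS S x → memS S y → memS S (addPt x y)
      *-closed : ∀ a x → memS S x → memS S (scalePt a x)

  T-isSubspace : ∀ S → T (isSubspaceᵇ S) → IsSubspace S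
  T-isSubspace S t = record
    { ∋0 = proj₁ (T-∧ t)
    ; +-closed = λ x y mx my → T-imp (T-allFin _ (T-allFin _ (proj₁ (T-∧ (proj₂ (T-∧ {mem S zeroPt} t)))) x) y) (∧-T mx my)
    ; *-closed = λ a x mx → T-imp (T-allFin _ (T-allFin _ (proj₂ (T-∧ (proj₂ (T-∧ {mem S zeroPt} t)))) a) x) mx
    }

  isSubspace-T : ∀ S → IsSubspace S → T (isSubspaceᵇ S)
  isSubspace-T S s = ∧-T (IsSubspace.∋0 s) (∧-T
    (allFin-T _ (λ x → allFin-T _ (λ y → imp-T (λ m → IsSubspace.+-closed s x y (proj₁ (T-∧ m)) (proj₂ (T-∧ {mem S x} m))))))
    (allFin-T _ (λ a → allFin-T _ (λ x → imp-T (IsSubspace.*-closed s a x)))))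

  comb-closed : ∀ {S} → IsSubspace S → ∀ {k} (B : Fin k → 𝔽^ N) → (∀ i → memS S (C.enc (B i))) →
                ∀ c → memS S (C.enc (comb B c))
  comb-closed {S} s {zero} B h c = mem-subst S (C.enc-cong (λ j → sym (comb-zero B c j))) (IsSubspace.∋0 s)
  comb-closed {S} s {suc k} B h c =
    mem-subst S (C.dec-inj coords)
      (IsSubspace.+-closed s _ _ (IsSubspace.*-closed s (c zero) _ (h zero)) (comb-closed s (B ∘ suc) (h ∘ suc) (c ∘ suc)))
    where
    coords : ∀ j → coord (addPt (scalePt (c zero) (C.enc (B zero))) (C.enc (comb (B ∘ suc) (c ∘ suc)))) j ≡ coord (C.enc (comb B c)) j
    coords j = trans (coord-add _ _ j) (trans (cong₂ _+ᶠ_ (trans (coord-scale _ _ j) (cong (c zero *ᶠ_) (C.dec-enc (B zero) j)))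
                 (C.dec-enc (comb (B ∘ suc) (c ∘ suc)) j)) (trans (sym (comb-suc B c j)) (sym (C.dec-enc (comb B c) j))))

  record HasDim (k : ℕ) (S : Subset M) : Set where
    field
      isSubspace : IsSubspace S
      basis : Fin k → 𝔽^ N
      basis∈ : ∀ i → memS S (C.enc (basis i))
      independent : Independent basis
      spans : ∀ x → memS S x → Σ (𝔽^ k) λ c → x ≡ C.enc (comb basis c)

    comb∈ : ∀ c → memS S (C.enc (comb basis c))
    comb∈ = comb-closed isSubspace basis basis∈

  lincomb≡ : ∀ {k} (B : Fin k → Pt) (basis : Fin k → 𝔽^ N) → (∀ i j → coord (B i) j ≡ basis i j) →
             ∀ c → lincomb B (Coordinates.dec k c) ≡ C.enc (comb basis (Coordinates.dec k c))
  lincomb≡ {k} B basis e c = C.≗dec⇒enc≡ (λ j → trans (sumF≡∑ᶠ k _)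
    (trans (∑ᶠ-cong (λ i → cong (Coordinates.dec k c i *ᶠ_) (e i j))) (sym (C.dec-enc (comb basis (Coordinates.dec k c)) j))))

  T-hasDim : ∀ k S → T (hasDimᵇ k S) → HasDim k S
  T-hasDim k S t = record
    { isSubspace = T-isSubspace S (proj₁ (T-∧ t))
    ; basis = basis
    ; basis∈ = λ i → mem-subst S (sym (C.enc-dec (B i))) (T-allFin _ (proj₁ (T-∧ tb)) i)
    ; independent = independent
    ; spans = spans
    }
    where
    module K = Coordinates k
    w = T-anyFin _ (proj₂ (T-∧ {isSubspaceᵇ S} t))
    tb = proj₂ w
    B : Fin k → Pt
    B = finToFun {M} {k} (proj₁ w)
    basis : Fin k → 𝔽^ N
    basis i = coord (B i)
    t-indep = proj₁ (T-∧ (proj₂ (T-∧ {all (λ i → mem S (B i)) (allFin k)} tb)))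
    t-spans = proj₂ (T-∧ (proj₂ (T-∧ {all (λ i → mem S (B i)) (allFin k)} tb)))
    independent : Independent basis
    independent c h i = trans (sym (K.dec-enc c i)) (trans (cong (λ z → K.dec z i) c≡0) (K.dec-0ᶜ i))
      where
      lincomb≡0 : lincomb B (K.dec (K.enc c)) ≡ zeroPt
      lincomb≡0 = trans (lincomb≡ B basis (λ _ _ → refl) (K.enc c))
             (C.≗dec⇒enc≡ (λ j → trans (comb-cong basis (K.dec-enc c) j) (trans (h j) (sym (coord-zero j)))))
      c≡0 : K.enc c ≡ K.0ᶜ
      c≡0 = T-does (K.enc c ≟ funToFin {k} (λ _ → 0#))
             (T-imp (subst (λ z → T (not (z == zeroPt) ∨ (K.enc c == funToFin {k} (λ _ → 0#)))) lincomb≡0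
                           (T-allFin _ t-indep (K.enc c))) (does-T (zeroPt ≟ zeroPt) refl))
    spans : ∀ x → memS S x → Σ (𝔽^ k) λ c → x ≡ C.enc (comb basis c)
    spans x mx = K.dec c , trans (sym (T-does (lincomb B (finToFun c) ≟ x) tc)) (lincomb≡ B basis (λ _ _ → refl) c)
      where
      wc = T-anyFin _ (T-imp (T-allFin _ t-spans x) mx)
      c = proj₁ wc
      tc = proj₂ wc

  hasDim-T : ∀ k S → HasDim k S → T (hasDimᵇ k S)
  hasDim-T k S h = ∧-T (isSubspace-T S isSubspace) (anyFin-T _ b (∧-T t-basis∈ (∧-T t-indep t-spans)))
    where
    open HasDim h
    module K = Coordinates k
    b : Fin (M ^ k)
    b = funToFin {k} {M} (λ i → C.enc (basis i))
    B : Fin k → Pt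
    B = finToFun {M} {k} b
    B≡ : ∀ i → B i ≡ C.enc (basis i)
    B≡ i = finToFun-funToFin (λ i → C.enc (basis i)) i
    coord-B : ∀ i j → coord (B i) j ≡ basis i j
    coord-B i j = trans (cong (λ z → coord z j) (B≡ i)) (C.dec-enc (basis i) j)
    t-basis∈ : T (all (λ i → mem S (B i)) (allFin k))
    t-basis∈ = allFin-T _ (λ i → mem-subst S (sym (B≡ i)) (basis∈ i))
    t-indep : T (indepᵇ B)
    t-indep = allFin-T _ (λ c → imp-T (λ t → does-T (c ≟ K.0ᶜ)
             (K.dec≗0⇒≡0ᶜ (independent (K.dec c)
                 (λ j → trans (sym (C.dec-enc (comb basis (K.dec c)) j)) (trans (cong (λ z → coord z j) (sym (lincomb≡ B basis coord-B c)))
                   (trans (cong (λ z → coord z j) (T-does (lincomb B (finToFun c) ≟ zeroPt) t)) (coord-zero j))))))))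
    t-spans : T (spansᵇ B S)
    t-spans = allFin-T _ (λ x → imp-T (λ mx → let (c , x≡) = spans x mx in anyFin-T _ (K.enc c)
            (does-T (lincomb B (finToFun (K.enc c)) ≟ x)
              (trans (lincomb≡ B basis coord-B _) (trans (C.enc-cong (comb-cong basis (K.dec-enc c))) (sym x≡))))))

  ker : 𝔽^ N → Subset M
  ker a = tabulate (λ x → does (dot a (coord x) ≟ 0#))

  mem-ker : ∀ a x → mem (ker a) x ≡ does (dot a (coord x) ≟ 0#)
  mem-ker a x = lookup∘tabulate (λ x → does (dot a (coord x) ≟ 0#)) x

  ∈ker⇒ : ∀ a x → memS (ker a) x → dot a (coord x) ≡ 0#
  ∈ker⇒ a x m = T-does (dot a (coord x) ≟ 0#) (subst T (mem-ker a x) m)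

  ⇒∈ker : ∀ a x → dot a (coord x) ≡ 0# → memS (ker a) x
  ⇒∈ker a x e = subst T (sym (mem-ker a x)) (does-T (dot a (coord x) ≟ 0#) e)

  ker-isSubspace : ∀ a → IsSubspace (ker a)
  ker-isSubspace a = record
    { ∋0 = ⇒∈ker a zeroPt (trans (dot-cong {a = a} (λ _ → refl) coord-zero) (dot-0ʳ a))
    ; +-closed = λ x y mx my → ⇒∈ker a _ (trans (dot-cong {a = a} (λ _ → refl) (coord-add x y))
               (trans (dot-+ʳ a (coord x) (coord y)) (trans (cong₂ _+ᶠ_ (∈ker⇒ a x mx) (∈ker⇒ a y my)) (+-identityˡ 0#))))
    ; *-closed = λ c x mx → ⇒∈ker a _ (trans (dot-cong {a = a} (λ _ → refl) (coord-scale c x))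
               (trans (dot-*ʳ c a (coord x)) (trans (cong (c *ᶠ_) (∈ker⇒ a x mx)) (zeroʳ c))))
    }

  Nonzero : 𝔽^ N → Set
  Nonzero a = ¬ (∀ j → a j ≡ 0#)

  scale : Fin q → 𝔽^ N → 𝔽^ N
  scale t v j = t *ᶠ v j

  scale-injective : ∀ a → Nonzero a → ∀ t t' → (∀ j → t *ᶠ a j ≡ t' *ᶠ a j) → t ≡ t'
  scale-injective a a≢0 t t' e = trans (sym (cancel t)) (trans (cong (_*ᶠ y) (e m)) (cancel t'))
    where
    mw = nonzero-entry a a≢0
    m = proj₁ mw
    y = proj₁ (inverse (a m) (proj₂ mw))
    cancel : ∀ s → s *ᶠ a m *ᶠ y ≡ s
    cancel s = trans (*-assoc s (a m) y) (trans (cong (s *ᶠ_) (proj₂ (inverse (a m) (proj₂ mw)))) (*-identityʳ s))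

  ker-cong : ∀ {a b} → (∀ j → a j ≡ b j) → ker a ≡ ker b
  ker-cong a≗b = tabulate-cong (λ x → cong (λ s → does (s ≟ 0#)) (dot-cong a≗b (λ _ → refl)))

  ker-scale : ∀ a t → ¬ t ≡ 0# → ker (scale t a) ≡ ker a
  ker-scale a t t≢0 = subset-ext _ _ (λ x → trans (mem-ker _ x) (trans (T-ext
     (λ z → does-T (dot a (coord x) ≟ 0#) (x*y≡1⇒x*t≡0⇒t≡0 (proj₂ (inverse t t≢0)) (trans (sym (dot-*ˡ t a (coord x))) (T-does (dot (scale t a) (coord x) ≟ 0#) z))))
     (λ z → does-T (dot (scale t a) (coord x) ≟ 0#) (trans (dot-*ˡ t a (coord x)) (trans (cong (t *ᶠ_) (T-does (dot a (coord x) ≟ 0#) z)) (zeroʳ t)))))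
     (sym (mem-ker a x))))

  -- If a₀, a were independent, the dual basis would give a point of ker a₀ outside ker a.
  ker⊆ker⇒proportional : ∀ a₀ a → Nonzero a₀ → Nonzero a → (∀ x → memS (ker a₀) x → memS (ker a) x) →
    Σ (Fin q) λ t → (¬ t ≡ 0#) × (∀ j → a j ≡ t *ᶠ a₀ j)
  ker⊆ker⇒proportional a₀ a a₀≢0 a≢0 ker⊆ker with independent-or-dependent (pair a₀ a)
  ... | inj₁ ind = ⊥-elim (0≢1 (trans (sym (∈ker⇒ a X (ker⊆ker X X∈ker-a₀))) (trans (dot-X a) (trans (dot-comm a x) (dd (suc zero) (suc zero))))))
    where
    d = proj₁ (dualBasis (pair a₀ a) ind)
    dd = proj₂ (dualBasis (pair a₀ a) ind)
    x = d (suc zero)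
    X = C.enc x
    dot-X : ∀ b → dot b (coord X) ≡ dot b x
    dot-X b = dot-cong {a = b} (λ _ → refl) (C.dec-enc x)
    X∈ker-a₀ : memS (ker a₀) X
    X∈ker-a₀ = ⇒∈ker a₀ X (trans (dot-X a₀) (trans (dot-comm a₀ x) (dd (suc zero) zero)))
  ... | inj₂ (c , c·pair≡0 , c≢0) with c (suc zero) ≟ 0#
  ...   | yes c₁≡0 = ⊥-elim (a₀≢0 (λ j → x*y≡1⇒x*t≡0⇒t≡0 (proj₂ (inverse (c zero) c₀≢0)) (c₀a₀≡0 j)))
    where
    c₀a₀≡0 : ∀ j → c zero *ᶠ a₀ j ≡ 0#
    c₀a₀≡0 j = trans (sym (+-identityʳ _)) (trans (cong (c zero *ᶠ a₀ j +ᶠ_) (sym (trans (cong (_*ᶠ a j) c₁≡0) (zeroˡ (a j)))))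
                 (trans (sym (comb-pair a₀ a c j)) (c·pair≡0 j)))
    c₀≢0 : ¬ c zero ≡ 0#
    c₀≢0 c₀≡0 = c≢0 λ { zero → c₀≡0 ; (suc zero) → c₁≡0 }
  ...   | no c₁≢0 = t , t≢0 , a≡ta₀
    where
    y = proj₁ (inverse (c (suc zero)) c₁≢0)
    t = -ᶠ (y *ᶠ c zero)
    a≡ta₀ : ∀ j → a j ≡ t *ᶠ a₀ j
    a≡ta₀ j = y*x≡1⇒x*a+x'*b≡0⇒a≡-y*x'*b (trans (*-comm y _) (proj₂ (inverse (c (suc zero)) c₁≢0)))
                (trans (+-comm _ _) (trans (sym (comb-pair a₀ a c j)) (c·pair≡0 j)))
    t≢0 : ¬ t ≡ 0#
    t≢0 t≡0 = a≢0 (λ j → trans (a≡ta₀ j) (trans (cong (_*ᶠ a₀ j) t≡0) (zeroˡ (a₀ j))))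

  record Line (L : Subset M) : Set where
    field
      gen : 𝔽^ N
      gen≢0 : Nonzero gen
      ∈⇒multiple : ∀ x → memS L x → Σ (Fin q) λ t → x ≡ C.enc (scale t gen)
      multiple∈ : ∀ t → memS L (C.enc (scale t gen))
      isSubspace : IsSubspace L

    gen∈ : memS L (C.enc gen)
    gen∈ = mem-subst L (C.enc-cong (λ j → *-identityˡ (gen j))) (multiple∈ 1#)

  T-line : ∀ L → T (hasDimᵇ 1 L) → Line L
  T-line L t = record
    { gen = b zero
    ; gen≢0 = λ z → 0≢1 (sym (independent (λ _ → 1#) (λ j → trans (comb-single b _ j) (trans (*-identityˡ _) (z j))) zero))
    ; ∈⇒multiple = λ x mx → let (c , x≡) = spans x mx in c zero , trans x≡ (C.enc-cong (comb-single b c))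
    ; multiple∈ = λ s → mem-subst L (C.enc-cong (comb-single b (λ _ → s))) (comb∈ (λ _ → s))
    ; isSubspace = isSubspace
    }
    where
    open HasDim (T-hasDim 1 L t)
    b = basis

  proportional-lines-equal : ∀ L L' (ln : Line L) (ln' : Line L') t → ¬ t ≡ 0# →
    (∀ j → Line.gen ln j ≡ t *ᶠ Line.gen ln' j) → L ≡ L'
  proportional-lines-equal L L' ln ln' t t≢0 g≡tg' = subset-ext L L' (λ x → T-ext (⊆ x) (⊇ x))
    where
    g = Line.gen ln
    g' = Line.gen ln'
    y = proj₁ (inverse t t≢0)
    g'≡yg : ∀ j → g' j ≡ y *ᶠ g j
    g'≡yg j = trans (sym (*-identityˡ (g' j))) (trans (cong (_*ᶠ g' j) (trans (sym (proj₂ (inverse t t≢0))) (*-comm t y)))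
               (trans (*-assoc y t (g' j)) (cong (y *ᶠ_) (sym (g≡tg' j)))))
    ⊆ : ∀ x → memS L x → memS L' x
    ⊆ x m = let (s , x≡) = Line.∈⇒multiple ln x m in
      mem-subst L' (sym (trans x≡ (C.enc-cong (λ j → trans (cong (s *ᶠ_) (g≡tg' j)) (sym (*-assoc s t (g' j)))))))
        (Line.multiple∈ ln' (s *ᶠ t))
    ⊇ : ∀ x → memS L' x → memS L x
    ⊇ x m = let (s , x≡) = Line.∈⇒multiple ln' x m in
      mem-subst L (sym (trans x≡ (C.enc-cong (λ j → trans (cong (s *ᶠ_) (g'≡yg j)) (sym (*-assoc s y (g j)))))))
        (Line.multiple∈ ln (s *ᶠ y))

  contained-ker : ∀ L (l : Line L) a → containedᵇ L (ker a) ≡ does (dot a (Line.gen l) ≟ 0#)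
  contained-ker L l a = T-ext
    (λ t → does-T (dot a g ≟ 0#) (trans (sym (dot-gen a)) (∈ker⇒ a _ (T-imp (T-allFin _ t (C.enc (scale 1# g))) (Line.multiple∈ l 1#)))))
    (λ t → allFin-T _ (λ x → imp-T (λ mx → ⇒∈ker a x (ker∋gen⇒ker∋ x mx (T-does (dot a g ≟ 0#) t)))))
    where
    g = Line.gen l
    dot-gen : ∀ a → dot a (coord (C.enc (scale 1# g))) ≡ dot a g
    dot-gen a = dot-cong {a = a} (λ _ → refl) (λ j → trans (C.dec-enc (scale 1# g) j) (*-identityˡ (g j)))
    ker∋gen⇒ker∋ : ∀ x → memS L x → dot a g ≡ 0# → dot a (coord x) ≡ 0#
    ker∋gen⇒ker∋ x mx a·g≡0 = let (s , x≡) = Line.∈⇒multiple l x mx in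
      trans (dot-cong {a = a} (λ _ → refl) (λ j → trans (cong (λ u → coord u j) x≡) (C.dec-enc (scale s g) j)))
            (trans (dot-*ʳ s a g) (trans (cong (s *ᶠ_) a·g≡0) (zeroʳ _)))

  AllLines : List (Subset M) → Set
  AllLines = All (λ L → T (hasDimᵇ 1 L))

  generators : (P : List (Subset M)) → AllLines P → Fin (length P) → 𝔽^ N
  generators (L ∷ P) (h ∷ hs) zero = Line.gen (T-line L h)
  generators (L ∷ P) (h ∷ hs) (suc i) = generators P hs i

  generator-line : ∀ (P : List (Subset M)) (hs : AllLines P) l → Σ (Line (lookup P l)) λ ln → ∀ j → Line.gen ln j ≡ generators P hs l j
  generator-line (L ∷ P) (h ∷ hs) zero = T-line L h , (λ _ → refl)
  generator-line (L ∷ P) (h ∷ hs) (suc l) = generator-line P hs l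

  generator≢0 : ∀ (P : List (Subset M)) (hs : AllLines P) l → Nonzero (generators P hs l)
  generator≢0 P hs l z = let (ln , gen≡) = generator-line P hs l in Line.gen≢0 ln (λ j → trans (gen≡ j) (z j))

  distinguishes-ker : ∀ a (P : List (Subset M)) (hs : AllLines P) → distinguishesᵇ (ker a) P ≡ allNonzero (λ i → dot a (generators P hs i))
  distinguishes-ker a [] [] = refl
  distinguishes-ker a (L ∷ P) (h ∷ hs) = cong₂ _∧_ (cong not (contained-ker L (T-line L h) a)) (distinguishes-ker a P hs)

  ∈⁅x⁆ : ∀ {m} (x : Fin m) → T (lookupᵛ ⁅ x ⁆ x)
  ∈⁅x⁆ zero = tt
  ∈⁅x⁆ (suc x) = ∈⁅x⁆ x

  ∈⁅y⁆⇒≡ : ∀ {m} (y x : Fin m) → T (lookupᵛ ⁅ y ⁆ x) → x ≡ y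
  ∈⁅y⁆⇒≡ zero zero t = refl
  ∈⁅y⁆⇒≡ {suc m} zero (suc x) t = ⊥-elim (subst T (lookup-replicate x false) t)
  ∈⁅y⁆⇒≡ (suc y) (suc x) t = cong suc (∈⁅y⁆⇒≡ y x t)

  mem-sumSub : ∀ A B x → mem (sumSub A B) x ≡ any (λ a → mem A a ∧ mem B (subPt x a)) allPts
  mem-sumSub A B x = lookup∘tabulate (λ x → any (λ a → mem A a ∧ mem B (subPt x a)) allPts) x

  ∈sumSub : ∀ A B x a → memS A a → memS B (subPt x a) → memS (sumSub A B) x
  ∈sumSub A B x a ma mb = subst T (sym (mem-sumSub A B x)) (anyFin-T _ a (∧-T ma mb))

  sumSub⇒ : ∀ A B x → memS (sumSub A B) x → Σ Pt λ a → memS A a × memS B (subPt x a)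
  sumSub⇒ A B x m = let (a , t) = T-anyFin _ (subst T (mem-sumSub A B x) m) in a , T-∧ t

  subPt-self : ∀ x → subPt x x ≡ zeroPt
  subPt-self x = C.dec-inj (λ j → trans (coord-sub x x j) (trans (-‿inverseʳ (coord x j)) (sym (coord-zero j))))

  subPt-zero : ∀ x → subPt x zeroPt ≡ x
  subPt-zero x = C.dec-inj (λ j → trans (coord-sub x zeroPt j)
    (trans (cong (λ t → coord x j +ᶠ -ᶠ t) (coord-zero j)) (trans (cong (coord x j +ᶠ_) -0#≈0#) (+-identityʳ _))))

  0∈span : ∀ (P : List (Subset M)) → AllLines P → memS (span P) zeroPt
  0∈span [] [] = ∈⁅x⁆ zeroPt
  0∈span (L ∷ P) (h ∷ hs) = ∈sumSub L (span P) zeroPt zeroPt (IsSubspace.∋0 (Line.isSubspace (T-line L h)))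
    (subst (memS (span P)) (sym (subPt-self zeroPt)) (0∈span P hs))

  generators∈span : ∀ (P : List (Subset M)) (hs : AllLines P) i → memS (span P) (C.enc (generators P hs i))
  generators∈span (L ∷ P) (h ∷ hs) zero = ∈sumSub L (span P) _ _ (Line.gen∈ (T-line L h))
    (subst (memS (span P)) (sym (subPt-self _)) (0∈span P hs))
  generators∈span (L ∷ P) (h ∷ hs) (suc i) = ∈sumSub L (span P) _ zeroPt (IsSubspace.∋0 (Line.isSubspace (T-line L h)))
    (subst (memS (span P)) (sym (subPt-zero _)) (generators∈span P hs i))

  span⇒comb-generators : ∀ (P : List (Subset M)) (hs : AllLines P) x → memS (span P) x → Σ (𝔽^ (length P)) λ c → x ≡ C.enc (comb (generators P hs) c)
  span⇒comb-generators [] [] x m = (λ ()) , trans (∈⁅y⁆⇒≡ zeroPt x m) (C.enc-cong (λ j → sym (comb-zero (generators [] []) (λ ()) j)))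
  span⇒comb-generators (L ∷ P) (h ∷ hs) x m = cons t c , pt≡enc x _ coords
    where
    l = T-line L h
    w = sumSub⇒ L (span P) x m
    a = proj₁ w
    ta = Line.∈⇒multiple l a (proj₁ (proj₂ w))
    t = proj₁ ta
    IH = span⇒comb-generators P hs (subPt x a) (proj₂ (proj₂ w))
    c = proj₁ IH
    coords : ∀ j → coord x j ≡ comb (generators (L ∷ P) (h ∷ hs)) (cons t c) j
    coords j = begin
      coord x j                                     ≡⟨ sym (x-y+y≡x (coord x j) (coord a j)) ⟩
      coord x j +ᶠ -ᶠ coord a j +ᶠ coord a j        ≡⟨ +-comm _ _ ⟩
      coord a j +ᶠ (coord x j +ᶠ -ᶠ coord a j)      ≡⟨ cong₂ _+ᶠ_ (trans (cong (λ u → coord u j) (proj₂ ta)) (C.dec-enc (scale t (Line.gen l)) j))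
                                                       (trans (sym (coord-sub x a j)) (trans (cong (λ u → coord u j) (proj₂ IH)) (C.dec-enc (comb (generators P hs) c) j))) ⟩
      t *ᶠ Line.gen l j +ᶠ comb (generators P hs) c j ≡⟨ sym (comb-cons (generators (L ∷ P) (h ∷ hs)) t c j) ⟩
      comb (generators (L ∷ P) (h ∷ hs)) (cons t c) j ∎
      where open ≡-Reasoning

  -- Expressing a basis of the span in the generators is an injective map F^i → F^i, hence onto;
  -- so a vanishing combination of the generators has the same coordinates as the zero combination.
  generators-independent : ∀ (P : List (Subset M)) (hs : AllLines P) → HasDim (length P) (span P) → Independent (generators P hs)
  generators-independent P hs h λ' λ'-vanishes i with all? (λ i → λ' i ≟ 0#)
  ... | yes λ'≡0 = λ'≡0 i
  ... | no λ'≢0 = ⊥-elim (λ'≢0 (λ i → trans (sym (K.dec-enc λ' i)) (trans (cong (λ z → K.dec z i) λ'≡0ᶜ) (K.dec-0ᶜ i))))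
    where
    module K = Coordinates (length P)
    gs = generators P hs
    open HasDim h using (basis; comb∈)
    in-generators : ∀ c → Σ (𝔽^ (length P)) λ d → C.enc (comb basis (K.dec c)) ≡ C.enc (comb gs d)
    in-generators c = span⇒comb-generators P hs (C.enc (comb basis (K.dec c))) (comb∈ (K.dec c))
    φ : K.Code → K.Code
    φ c = K.enc (proj₁ (in-generators c))
    comb-φ : ∀ c j → comb gs (K.dec (φ c)) j ≡ comb basis (K.dec c) j
    comb-φ c j = trans (comb-cong gs (K.dec-enc (proj₁ (in-generators c))) j)
      (trans (sym (C.dec-enc (comb gs (proj₁ (in-generators c))) j)) (trans (cong (λ u → coord u j) (sym (proj₂ (in-generators c)))) (C.dec-enc (comb basis (K.dec c)) j)))
    basis-injective : ∀ c c' → (∀ j → comb basis (K.dec c) j ≡ comb basis (K.dec c') j) → c ≡ c'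
    basis-injective c c' e = K.dec-inj (λ i → x-y≡0⇒x≡y (HasDim.independent h (λ i → K.dec c i +ᶠ -ᶠ K.dec c' i)
       (λ j → trans (comb-sub basis (K.dec c) (K.dec c') j) (trans (cong (_+ᶠ -ᶠ comb basis (K.dec c') j) (e j)) (-‿inverseʳ _))) i))
    φ-injective : ∀ {c c'} → φ c ≡ φ c' → c ≡ c'
    φ-injective {c} {c'} e = basis-injective c c' (λ j → trans (sym (comb-φ c j)) (trans (cong (λ z → comb gs (K.dec z) j) e) (comb-φ c' j)))
    φ⁻¹0 : ∀ c y → (∀ j → comb gs (K.dec y) j ≡ 0#) → φ c ≡ y → c ≡ K.0ᶜ
    φ⁻¹0 c y gs·y≡0 e = basis-injective c K.0ᶜ (λ j → trans (sym (comb-φ c j)) (trans (cong (λ z → comb gs (K.dec z) j) e)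
       (trans (gs·y≡0 j) (sym (trans (comb-cong basis K.dec-0ᶜ j) (comb-0 basis j))))))
    pre-λ' = injective⇒surjective φ φ-injective (K.enc λ')
    pre-0 = injective⇒surjective φ φ-injective K.0ᶜ
    λ'≡0ᶜ : K.enc λ' ≡ K.0ᶜ
    λ'≡0ᶜ = begin
      K.enc λ'          ≡⟨ sym (proj₂ pre-λ') ⟩
      φ (proj₁ pre-λ')  ≡⟨ cong φ (trans (φ⁻¹0 _ _ (λ j → trans (comb-cong gs (K.dec-enc λ') j) (λ'-vanishes j)) (proj₂ pre-λ'))
                                         (sym (φ⁻¹0 _ _ (λ j → trans (comb-cong gs K.dec-0ᶜ j) (comb-0 gs j)) (proj₂ pre-0)))) ⟩
      φ (proj₁ pre-0)   ≡⟨ proj₂ pre-0 ⟩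
      K.0ᶜ              ∎
      where open ≡-Reasoning

  All-lookup : ∀ {A : Set} {R : A → Set} (xs : List A) → All R xs → ∀ l → R (lookup xs l)
  All-lookup (x ∷ xs) (r ∷ rs) zero = r
  All-lookup (x ∷ xs) (r ∷ rs) (suc l) = All-lookup xs rs l

  Unique-lookup : ∀ {A : Set} (xs : List A) → Unique xs → ∀ l l' → l ≢ l' → lookup xs l ≢ lookup xs l'
  Unique-lookup (x ∷ xs) (a ∷ u) zero zero ne = ⊥-elim (ne refl)
  Unique-lookup (x ∷ xs) (a ∷ u) zero (suc l') ne = All-lookup xs a l'
  Unique-lookup (x ∷ xs) (a ∷ u) (suc l) zero ne e = All-lookup xs a l (sym e)
  Unique-lookup (x ∷ xs) (a ∷ u) (suc l) (suc l') ne = Unique-lookup xs u l l' (ne ∘ cong suc)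

  distinct-generators-independent : ∀ (P : List (Subset M)) (hs : AllLines P) → Unique P → ∀ l l' → l ≢ l' →
    Independent (pair (generators P hs l) (generators P hs l'))
  distinct-generators-independent P hs u l l' l≢l' c c·pair≡0 with c zero ≟ 0#
  ... | yes c₀≡0 = λ { zero → c₀≡0 ; (suc zero) → c₁≡0 }
    where
    g' = generators P hs l'
    c₁≡0 : c (suc zero) ≡ 0#
    c₁≡0 = scale-injective g' (generator≢0 P hs l') (c (suc zero)) 0# (λ j → trans (sym (+-identityˡ _))
      (trans (cong (_+ᶠ c (suc zero) *ᶠ g' j) (sym (trans (cong (_*ᶠ generators P hs l j) c₀≡0) (zeroˡ _))))
      (trans (sym (comb-pair (generators P hs l) g' c j)) (trans (c·pair≡0 j) (sym (zeroˡ (g' j)))))))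
  ... | no c₀≢0 = ⊥-elim (Unique-lookup P u l l' l≢l' (proportional-lines-equal _ _ (proj₁ gl) (proj₁ gl') t t≢0 gen≡t·gen'))
    where
    gl = generator-line P hs l
    gl' = generator-line P hs l'
    y = proj₁ (inverse (c zero) c₀≢0)
    t = -ᶠ (y *ᶠ c (suc zero))
    g≡t·g' : ∀ j → generators P hs l j ≡ t *ᶠ generators P hs l' j
    g≡t·g' j = y*x≡1⇒x*a+x'*b≡0⇒a≡-y*x'*b (trans (*-comm y _) (proj₂ (inverse (c zero) c₀≢0)))
                 (trans (sym (comb-pair (generators P hs l) (generators P hs l') c j)) (c·pair≡0 j))
    gen≡t·gen' : ∀ j → Line.gen (proj₁ gl) j ≡ t *ᶠ Line.gen (proj₁ gl') j
    gen≡t·gen' j = trans (proj₂ gl j) (trans (g≡t·g' j) (cong (t *ᶠ_) (sym (proj₂ gl' j))))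
    t≢0 : ¬ t ≡ 0#
    t≢0 t≡0 = Line.gen≢0 (proj₁ gl) (λ j → trans (gen≡t·gen' j) (trans (cong (_*ᶠ Line.gen (proj₁ gl') j) t≡0) (zeroˡ _)))

  extend-independent : ∀ {k S} (h : HasDim k S) x → ¬ memS S x → Independent (cons (coord x) (HasDim.basis h))
  extend-independent {k} {S} h x x∉S c c·B≡0 = all-zero
    where
    open HasDim h
    split : ∀ j → c zero *ᶠ coord x j +ᶠ comb basis (c ∘ suc) j ≡ 0#
    split j = trans (sym (comb-suc (cons (coord x) basis) c j)) (c·B≡0 j)
    c₀≡0 : c zero ≡ 0#
    c₀≡0 with c zero ≟ 0#
    ... | yes c₀≡0 = c₀≡0
    ... | no c₀≢0 = ⊥-elim (x∉S (mem-subst S (sym (pt≡enc x _ x≡comb)) (comb∈ _)))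
      where
      y = proj₁ (inverse (c zero) c₀≢0)
      x≡comb : ∀ j → coord x j ≡ comb basis (λ i → -ᶠ (y *ᶠ c (suc i))) j
      x≡comb j = trans (y*x≡1⇒x*a+b≡0⇒a≡-y*b (trans (*-comm y _) (proj₂ (inverse (c zero) c₀≢0))) (split j))
                       (comb-neg-* basis y (c ∘ suc) j)
    all-zero : ∀ i → c i ≡ 0#
    all-zero zero = c₀≡0
    all-zero (suc i) = independent (c ∘ suc) (λ j → trans (sym (+-identityˡ _))
      (trans (cong (_+ᶠ comb basis (c ∘ suc) j) (sym (trans (cong (_*ᶠ coord x j) c₀≡0) (zeroˡ _)))) (split j))) i

module Hyperplanes {q : ℕ} (F : FiniteField q) (n : ℕ) where
  open import Data.Nat using (zero; suc; _^_; _∸_; _+_; _*_; _≤_)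
  import Data.Nat.Properties as ℕP
  open import Data.Nat.Tactic.RingSolver using (solve-∀)
  open import Data.Fin using (Fin; zero; suc; _≟_; punchIn; punchOut)
  open import Data.Fin.Properties using (punchIn-punchOut; punchInᵢ≢i)
  open import Data.Fin.Subset using (Subset)
  open import Data.Product using (Σ; _×_; _,_; proj₁; proj₂)
  open import Data.Empty using (⊥-elim)
  open import Data.Bool using (Bool; true; false; T; _∧_; not)
  open import Data.Bool.Properties using (T?; ∧-identityʳ)
  open import Data.List using (List; _∷_; length)
  open import Data.List.Relation.Unary.All using (_∷_)
  open import Data.List.Relation.Unary.Unique.Propositional using (Unique)
  open import Relation.Nullary using (¬_; Dec; yes; no; does)
  open import Relation.Binary.PropositionalEquality
  open import Function using (_∘_)

  N : ℕ
  N = suc n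

  open IndicatorSums
  open BoolReflection
  open SubsetEnumeration
  open LinearAlgebra F renaming (_+_ to _+ᶠ_; _*_ to _*ᶠ_; -_ to -ᶠ_)
  open Counting F
  open Geometry F N
  open Subspaces F N

  -- Solving a·x = 0 for the coordinate at a pivot m with a m ≠ 0 leaves the other n coordinates free.
  module PivotBasis (a : 𝔽^ N) (a≢0 : Nonzero a) where
    m : Fin N
    m = proj₁ (nonzero-entry a a≢0)
    y : Fin q
    y = proj₁ (inverse (a m) (proj₂ (nonzero-entry a a≢0)))
    am*y≡1 : a m *ᶠ y ≡ 1#
    am*y≡1 = proj₂ (inverse (a m) (proj₂ (nonzero-entry a a≢0)))
    p : Fin n → Fin N
    p = punchIn m
    basis : Fin n → 𝔽^ N
    basis i l = unitVec (p i) l +ᶠ -ᶠ ((a (p i) *ᶠ y) *ᶠ unitVec m l)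
    basis∈ : ∀ i → memS (ker a) (C.enc (basis i))
    basis∈ i = ⇒∈ker a _ (trans (dot-cong {a = a} (λ _ → refl) (C.dec-enc (basis i)))
      (trans (dot-subscaleʳ a (unitVec (p i)) (unitVec m) (a (p i) *ᶠ y))
        (trans (cong₂ (λ s t → s +ᶠ -ᶠ ((a (p i) *ᶠ y) *ᶠ t)) (dot-unitVecʳ a (p i)) (dot-unitVecʳ a m))
          (trans (cong (λ t → a (p i) +ᶠ -ᶠ t) (b*y*am≡b (a (p i)))) (-‿inverseʳ (a (p i)))))))
      where
      b*y*am≡b : ∀ b → b *ᶠ y *ᶠ a m ≡ b
      b*y*am≡b b = trans (*-assoc b y (a m)) (trans (cong (b *ᶠ_) (trans (*-comm y (a m)) am*y≡1)) (*-identityʳ b))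
    basis-p : ∀ i' i → basis i' (p i) ≡ δ i' i
    basis-p i' i = trans (cong₂ (λ s t → s +ᶠ -ᶠ ((a (p i') *ᶠ y) *ᶠ t)) (δ-punchIn m i i') (δ-pivot-punchIn m i))
      (trans (cong (λ t → δ i' i +ᶠ -ᶠ t) (zeroʳ _)) (trans (cong (δ i' i +ᶠ_) -0#≈0#) (+-identityʳ _)))
    comb-p : ∀ c i → comb basis c (p i) ≡ c i
    comb-p c i = trans (∑ᶠ-cong (λ i' → cong (c i' *ᶠ_) (basis-p i' i))) (∑ᶠ-δʳ i c)
    basis-m : ∀ i → basis i m ≡ -ᶠ (a (p i) *ᶠ y)
    basis-m i = trans (cong₂ (λ s t → s +ᶠ -ᶠ ((a (p i) *ᶠ y) *ᶠ t)) (δ-off (punchInᵢ≢i m i)) (δ-diag m))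
      (trans (+-identityˡ _) (cong -ᶠ_ (*-identityʳ _)))
    spans : ∀ x → memS (ker a) x → Σ (𝔽^ n) λ c → x ≡ C.enc (comb basis c)
    spans x mx = c , pt≡enc x (comb basis c) coords
      where
      c : 𝔽^ n
      c i = coord x (p i)
      a·x≡0 : a m *ᶠ coord x m +ᶠ ∑ᶠ n (λ i → a (p i) *ᶠ c i) ≡ 0#
      a·x≡0 = trans (sym (∑ᶠ-remove m (λ j → a j *ᶠ coord x j))) (∈ker⇒ a x mx)
      rest≡ : ∑ᶠ n (λ i → a (p i) *ᶠ c i) ≡ -ᶠ (a m *ᶠ coord x m)
      rest≡ = x+y≡0⇒x≡-y (trans (+-comm _ _) a·x≡0)
      at-pivot : comb basis c m ≡ coord x m
      at-pivot = begin
        comb basis c m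
          ≡⟨ ∑ᶠ-cong (λ i → trans (cong (c i *ᶠ_) (basis-m i))
               (trans (sym (-‿distribʳ-* (c i) _)) (cong -ᶠ_ (trans (sym (*-assoc (c i) (a (p i)) y)) (cong (_*ᶠ y) (*-comm (c i) (a (p i)))))))) ⟩
        ∑ᶠ n (λ i → -ᶠ (a (p i) *ᶠ c i *ᶠ y))      ≡⟨ ∑ᶠ-neg _ ⟩
        -ᶠ ∑ᶠ n (λ i → a (p i) *ᶠ c i *ᶠ y)        ≡⟨ cong -ᶠ_ (∑ᶠ-*ʳ y (λ i → a (p i) *ᶠ c i)) ⟩
        -ᶠ (∑ᶠ n (λ i → a (p i) *ᶠ c i) *ᶠ y)      ≡⟨ cong (λ t → -ᶠ (t *ᶠ y)) rest≡ ⟩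
        -ᶠ (-ᶠ (a m *ᶠ coord x m) *ᶠ y)            ≡⟨ cong -ᶠ_ (sym (-‿distribˡ-* _ y)) ⟩
        -ᶠ (-ᶠ (a m *ᶠ coord x m *ᶠ y))            ≡⟨ -‿involutive _ ⟩
        a m *ᶠ coord x m *ᶠ y                      ≡⟨ cong (_*ᶠ y) (*-comm (a m) (coord x m)) ⟩
        coord x m *ᶠ a m *ᶠ y                      ≡⟨ *-assoc (coord x m) (a m) y ⟩
        coord x m *ᶠ (a m *ᶠ y)                    ≡⟨ cong (coord x m *ᶠ_) am*y≡1 ⟩
        coord x m *ᶠ 1#                            ≡⟨ *-identityʳ _ ⟩
        coord x m                                  ∎
        where open ≡-Reasoning
      coords : ∀ l → coord x l ≡ comb basis c l
      coords l = by-cases (m ≟ l)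
        where
        by-cases : Dec (m ≡ l) → coord x l ≡ comb basis c l
        by-cases (yes m≡l) = subst (λ l → coord x l ≡ comb basis c l) m≡l (sym at-pivot)
        by-cases (no m≢l) = subst (λ l → coord x l ≡ comb basis c l) (punchIn-punchOut m≢l) (sym (comb-p c (punchOut m≢l)))

  ker-hyperplane : ∀ a → Nonzero a → HasDim n (ker a)
  ker-hyperplane a a≢0 = record
    { isSubspace = ker-isSubspace a
    ; basis = basis
    ; basis∈ = basis∈
    ; independent = λ c h i → trans (sym (comb-p c i)) (h (p i))
    ; spans = spans
    }
    where open PivotBasis a a≢0

  -- A point of ker a outside S would extend the basis of S to N independent vectors killed by a ≠ 0.
  hyperplane⇒ker : ∀ S → HasDim n S → Σ (𝔽^ N) λ a → Nonzero a × S ≡ ker a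
  hyperplane⇒ker S h = a , a≢0 , subset-ext S (ker a) (λ x → T-ext (S⊆ker x) (ker⊆S x))
    where
    open HasDim h
    nontrivial = Kernel.nontrivial-kernel basis independent ℕP.≤-refl
    a = proj₁ nontrivial
    a≢0 = proj₁ (proj₂ nontrivial)
    a·basis≡0 : ∀ i → dot a (basis i) ≡ 0#
    a·basis≡0 = proj₂ (proj₂ nontrivial)
    S⊆ker : ∀ x → memS S x → memS (ker a) x
    S⊆ker x mx = let (c , x≡) = spans x mx in
      ⇒∈ker a x (trans (dot-cong {a = a} (λ _ → refl) (λ j → trans (cong (λ z → coord z j) x≡) (C.dec-enc (comb basis c) j)))
        (trans (dot-combʳ basis c a) (trans (∑ᶠ-cong (λ i → cong (c i *ᶠ_) (a·basis≡0 i))) (∑ᶠ-*0 c))))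
    ker⊆S : ∀ x → memS (ker a) x → memS S x
    ker⊆S x kx with T? (mem S x)
    ... | yes x∈S = x∈S
    ... | no x∉S = ⊥-elim (a≢0 (Kernel.trivial-kernel (cons (coord x) basis) (extend-independent h x x∉S) ℕP.≤-refl a a·extended≡0))
      where
      a·extended≡0 : ∀ i → dot a (cons (coord x) basis i) ≡ 0#
      a·extended≡0 zero = ∈ker⇒ a x kx
      a·extended≡0 (suc i) = a·basis≡0 i

  isNonzeroPt : Pt → Bool
  isNonzeroPt e = not (does (e ≟ zeroPt))

  T-isNonzeroPt : ∀ e → T (isNonzeroPt e) → Nonzero (coord e)
  T-isNonzeroPt e t z = T-not t (does-T (e ≟ zeroPt) (C.dec-inj (λ j → trans (z j) (sym (coord-zero j)))))

  isNonzeroPt-T : ∀ e → Nonzero (coord e) → T (isNonzeroPt e)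
  isNonzeroPt-T e e≢0 = not-T (λ t → e≢0 (λ j → trans (cong (λ u → coord u j) (T-does (e ≟ zeroPt) t)) (coord-zero j)))

  multiple : 𝔽^ N → Pt → Fin q → ℕ
  multiple a₀ e t = 𝟙 (isNonzero t) * 𝟙 (does (C.enc (scale t a₀) ≟ e))

  -- The nonzero functionals with kernel ker a₀ are exactly the t·a₀ with t ≠ 0.
  𝟙-same-ker≡∑-multiple : ∀ a₀ → Nonzero a₀ → ∀ e →
    𝟙 (does (ker (coord e) ≟ˢ ker a₀) ∧ isNonzeroPt e) ≡ ∑[ t < q ] multiple a₀ e t
  𝟙-same-ker≡∑-multiple a₀ a₀≢0 e with T? (does (ker (coord e) ≟ˢ ker a₀) ∧ isNonzeroPt e)
  ... | yes same-ker = trans (𝟙-T same-ker) (sym (trans (∑-single t₀ (multiple a₀ e) others)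
        (cong₂ _*_ (𝟙-T (not-T (λ z → t₀≢0 (T-does (t₀ ≟ 0#) z)))) (𝟙-T (does-T (C.enc (scale t₀ a₀) ≟ e) (sym e≡t₀a₀))))))
    where
    ker≡ : ker (coord e) ≡ ker a₀
    ker≡ = T-does (ker (coord e) ≟ˢ ker a₀) (proj₁ (T-∧ same-ker))
    prop = ker⊆ker⇒proportional a₀ (coord e) a₀≢0 (T-isNonzeroPt e (proj₂ (T-∧ {does (ker (coord e) ≟ˢ ker a₀)} same-ker)))
             (λ x m → subst (λ S → memS S x) (sym ker≡) m)
    t₀ : Fin q
    t₀ = proj₁ prop
    t₀≢0 : ¬ t₀ ≡ 0#
    t₀≢0 = proj₁ (proj₂ prop)
    e≡t₀a₀ : e ≡ C.enc (scale t₀ a₀)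
    e≡t₀a₀ = pt≡enc e _ (proj₂ (proj₂ prop))
    others : ∀ t → t ≢ t₀ → multiple a₀ e t ≡ 0
    others t t≢t₀ = 𝟙*𝟙-disjoint (isNonzero t) (does (C.enc (scale t a₀) ≟ e)) (λ _ d → t≢t₀ (scale-injective a₀ a₀≢0 t t₀
       (λ j → trans (sym (C.dec-enc (scale t a₀) j)) (trans (cong (λ u → coord u j) (trans (T-does (_ ≟ e) d) e≡t₀a₀)) (C.dec-enc (scale t₀ a₀) j)))))
  ... | no different = trans (𝟙-¬T different) (sym (trans (sum-cong-≗ {q} (λ t → 𝟙*𝟙-disjoint (isNonzero t) _
          (λ t≢0 d → different (same-ker t (λ z → T-not t≢0 (does-T (t ≟ 0#) z)) (T-does (_ ≟ e) d))))) (sum-replicate-zero q)))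
    where
    same-ker : ∀ t → ¬ t ≡ 0# → C.enc (scale t a₀) ≡ e → T (does (ker (coord e) ≟ˢ ker a₀) ∧ isNonzeroPt e)
    same-ker t t≢0 ta₀≡e = ∧-T (subst (λ S → T (does (S ≟ˢ ker a₀))) (sym ker≡) (does-T (ker a₀ ≟ˢ ker a₀) refl))
                             (isNonzeroPt-T e (λ z → *-≢0 t≢0 (proj₂ m≢0) (trans (sym (coord-e (proj₁ m≢0))) (z (proj₁ m≢0)))))
      where
      coord-e : ∀ j → coord e j ≡ t *ᶠ a₀ j
      coord-e j = trans (cong (λ u → coord u j) (sym ta₀≡e)) (C.dec-enc (scale t a₀) j)
      ker≡ : ker (coord e) ≡ ker a₀
      ker≡ = trans (ker-cong coord-e) (ker-scale a₀ t t≢0)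
      m≢0 = nonzero-entry a₀ a₀≢0

  count-functionals-with-ker : ∀ a₀ → Nonzero a₀ → ∑[ e < M ] 𝟙 (does (ker (coord e) ≟ˢ ker a₀) ∧ isNonzeroPt e) ≡ q ∸ 1
  count-functionals-with-ker a₀ a₀≢0 = begin
    ∑[ e < M ] 𝟙 (does (ker (coord e) ≟ˢ ker a₀) ∧ isNonzeroPt e) ≡⟨ sum-cong-≗ {M} (𝟙-same-ker≡∑-multiple a₀ a₀≢0) ⟩
    ∑[ e < M ] ∑[ t < q ] multiple a₀ e t                       ≡⟨ ∑-comm (multiple a₀) ⟩
    ∑[ t < q ] ∑[ e < M ] multiple a₀ e t                       ≡⟨ sum-cong-≗ {q} one-point ⟩
    ∑[ t < q ] 𝟙 (isNonzero t)                                  ≡⟨ ∑-𝟙-≢ 0# ⟩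
    q ∸ 1                                                       ∎
    where
    open ≡-Reasoning
    one-point : ∀ t → ∑[ e < M ] multiple a₀ e t ≡ 𝟙 (isNonzero t)
    one-point t = trans (∑-*ˡ (𝟙 (isNonzero t)) (λ e → 𝟙 (does (C.enc (scale t a₀) ≟ e))))
                        (trans (cong (𝟙 (isNonzero t) *_) (∑-𝟙-≟ (C.enc (scale t a₀)))) (ℕP.*-identityʳ _))

  count-functionals-for : ∀ V → ∑[ e < M ] 𝟙 (does (ker (coord e) ≟ˢ V) ∧ isNonzeroPt e) ≡ 𝟙 (hasDimᵇ n V) * (q ∸ 1)
  count-functionals-for V with T? (hasDimᵇ n V)
  ... | yes V-hyperplane = begin
    ∑[ e < M ] 𝟙 (does (ker (coord e) ≟ˢ V) ∧ isNonzeroPt e)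
      ≡⟨ cong (λ W → ∑[ e < M ] 𝟙 (does (ker (coord e) ≟ˢ W) ∧ isNonzeroPt e)) V≡ker ⟩
    ∑[ e < M ] 𝟙 (does (ker (coord e) ≟ˢ ker a) ∧ isNonzeroPt e)
      ≡⟨ count-functionals-with-ker a (proj₁ (proj₂ hk)) ⟩
    q ∸ 1
      ≡⟨ sym (ℕP.*-identityˡ _) ⟩
    1 * (q ∸ 1)
      ≡⟨ cong (_* (q ∸ 1)) (sym (𝟙-T V-hyperplane)) ⟩
    𝟙 (hasDimᵇ n V) * (q ∸ 1) ∎
    where
    open ≡-Reasoning
    hk = hyperplane⇒ker V (T-hasDim n V V-hyperplane)
    a = proj₁ hk
    V≡ker = proj₂ (proj₂ hk)
  ... | no not-hyperplane = trans (sum-cong-≗ {M} (λ e → 𝟙-¬T (not-hyperplane ∘ hyperplane e))) (trans (sum-replicate-zero M) (sym (cong (_* (q ∸ 1)) (𝟙-¬T not-hyperplane))))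
    where
    hyperplane : ∀ e → T (does (ker (coord e) ≟ˢ V) ∧ isNonzeroPt e) → T (hasDimᵇ n V)
    hyperplane e t = subst (λ W → T (hasDimᵇ n W)) (T-does (ker (coord e) ≟ˢ V) (proj₁ (T-∧ t)))
      (hasDim-T n _ (ker-hyperplane (coord e) (T-isNonzeroPt e (proj₂ (T-∧ {does (ker (coord e) ≟ˢ V)} t)))))

  -- Each hyperplane V is ker e for exactly q − 1 nonzero functionals e.
  ∑-hyperplanes-via-functionals : ∀ (D : Subset M → Bool) →
    ∑ᴸ (allSubsets M) (λ V → 𝟙 (hasDimᵇ n V ∧ D V)) * (q ∸ 1) ≡ ∑[ e < M ] 𝟙 (isNonzeroPt e ∧ D (ker (coord e)))
  ∑-hyperplanes-via-functionals D = sym (begin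
    ∑[ e < M ] 𝟙 (isNonzeroPt e ∧ D (ker (coord e)))
      ≡⟨ sum-cong-≗ {M} (λ e → sym (∑ᴸ-allSubsets-pick M (ker (coord e)) (λ V → 𝟙 (isNonzeroPt e ∧ D V)))) ⟩
    ∑[ e < M ] ∑ᴸ (allSubsets M) (λ V → 𝟙 (does (ker (coord e) ≟ˢ V)) * 𝟙 (isNonzeroPt e ∧ D V))
      ≡⟨ sym (∑ᴸ-∑ (allSubsets M) (λ V e → 𝟙 (does (ker (coord e) ≟ˢ V)) * 𝟙 (isNonzeroPt e ∧ D V))) ⟩
    ∑ᴸ (allSubsets M) (λ V → ∑[ e < M ] (𝟙 (does (ker (coord e) ≟ˢ V)) * 𝟙 (isNonzeroPt e ∧ D V)))
      ≡⟨ ∑ᴸ-cong (allSubsets M) (λ V → trans (sum-cong-≗ {M} (λ e → regroup (does (ker (coord e) ≟ˢ V)) (isNonzeroPt e) (D V)))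
            (trans (∑-*ˡ (𝟙 (D V)) (λ e → 𝟙 (does (ker (coord e) ≟ˢ V) ∧ isNonzeroPt e))) (cong (𝟙 (D V) *_) (count-functionals-for V)))) ⟩
    ∑ᴸ (allSubsets M) (λ V → 𝟙 (D V) * (𝟙 (hasDimᵇ n V) * (q ∸ 1)))
      ≡⟨ ∑ᴸ-cong (allSubsets M) (λ V → merge (hasDimᵇ n V) (D V) (q ∸ 1)) ⟩
    ∑ᴸ (allSubsets M) (λ V → 𝟙 (hasDimᵇ n V ∧ D V) * (q ∸ 1))
      ≡⟨ ∑ᴸ-*ʳ (allSubsets M) (q ∸ 1) (λ V → 𝟙 (hasDimᵇ n V ∧ D V)) ⟩
    ∑ᴸ (allSubsets M) (λ V → 𝟙 (hasDimᵇ n V ∧ D V)) * (q ∸ 1) ∎)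
    where
    open ≡-Reasoning
    regroup : ∀ a b c → 𝟙 a * 𝟙 (b ∧ c) ≡ 𝟙 c * 𝟙 (a ∧ b)
    regroup true true true = refl
    regroup true true false = refl
    regroup true false c = sym (ℕP.*-zeroʳ (𝟙 c))
    regroup false b c = sym (ℕP.*-zeroʳ (𝟙 c))
    merge : ∀ h c r → 𝟙 c * (𝟙 h * r) ≡ 𝟙 (h ∧ c) * r
    merge true true r = ℕP.*-identityˡ (1 * r)
    merge true false r = refl
    merge false true r = refl
    merge false false r = refl

  numGr*[q∸1]≡q^N∸1 : numGr n * (q ∸ 1) ≡ q ^ N ∸ 1
  numGr*[q∸1]≡q^N∸1 = begin
    numGr n * (q ∸ 1)
      ≡⟨ cong (_* (q ∸ 1)) (trans (length-filterᵇ (hasDimᵇ n) (allSubsets M)) (∑ᴸ-cong (allSubsets M) (λ V → cong 𝟙 (sym (∧-identityʳ (hasDimᵇ n V)))))) ⟩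
    ∑ᴸ (allSubsets M) (λ V → 𝟙 (hasDimᵇ n V ∧ true)) * (q ∸ 1)
      ≡⟨ ∑-hyperplanes-via-functionals (λ _ → true) ⟩
    ∑[ e < M ] 𝟙 (isNonzeroPt e ∧ true)
      ≡⟨ sum-cong-≗ {M} (λ e → cong 𝟙 (∧-identityʳ (isNonzeroPt e))) ⟩
    ∑[ e < M ] 𝟙 (isNonzeroPt e)
      ≡⟨ ∑-𝟙-≢ zeroPt ⟩
    q ^ N ∸ 1 ∎
    where open ≡-Reasoning

  -- A functional that is nonzero on some generator is itself nonzero.
  numDist*[q∸1] : ∀ (P : List (Subset M)) (hs : AllLines P) → 1 ≤ length P →
    numDist n P * (q ∸ 1) ≡ ∑[ e < M ] 𝟙 (allNonzero (λ l → dot (coord e) (generators P hs l)))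
  numDist*[q∸1] (L ∷ P) (h ∷ hs) _ = begin
    numDist n (L ∷ P) * (q ∸ 1)
      ≡⟨ cong (_* (q ∸ 1)) (length-filterᵇ (λ V → hasDimᵇ n V ∧ distinguishesᵇ V (L ∷ P)) (allSubsets M)) ⟩
    ∑ᴸ (allSubsets M) (λ V → 𝟙 (hasDimᵇ n V ∧ distinguishesᵇ V (L ∷ P))) * (q ∸ 1)
      ≡⟨ ∑-hyperplanes-via-functionals (λ V → distinguishesᵇ V (L ∷ P)) ⟩
    ∑[ e < M ] 𝟙 (isNonzeroPt e ∧ distinguishesᵇ (ker (coord e)) (L ∷ P))
      ≡⟨ sum-cong-≗ {M} (λ e → cong 𝟙 (trans (cong (isNonzeroPt e ∧_) (distinguishes-ker (coord e) (L ∷ P) (h ∷ hs))) (drop-isNonzeroPt e))) ⟩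
    ∑[ e < M ] 𝟙 (allNonzero (λ l → dot (coord e) (generators (L ∷ P) (h ∷ hs) l))) ∎
    where
    open ≡-Reasoning
    drop-isNonzeroPt : ∀ e → isNonzeroPt e ∧ allNonzero (λ l → dot (coord e) (generators (L ∷ P) (h ∷ hs) l))
                           ≡ allNonzero (λ l → dot (coord e) (generators (L ∷ P) (h ∷ hs) l))
    drop-isNonzeroPt e = T-ext (λ t → proj₂ (T-∧ {isNonzeroPt e} t))
      (λ t → ∧-T (isNonzeroPt-T e (λ e≡0 → T-not (proj₁ (T-∧ t))
                    (does-T (_ ≟ 0#) (trans (dot-cong {a = coord e} {a' = λ _ → 0#} e≡0 (λ _ → refl)) (dot-0ˡ _))))) t)

  -- Writing the generators in a basis B of a k-space turns the count into one over F^k;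
  -- every point of F^k is the value vector of exactly q^(N−k) functionals.
  numDist-via-basis : ∀ (P : List (Subset M)) (hs : AllLines P) → 1 ≤ length P → ∀ {k} (B : Fin k → 𝔽^ N) → Independent B → k ≤ N →
    (w : Fin (length P) → 𝔽^ k) → (∀ l j → generators P hs l j ≡ comb B (w l) j) →
    numDist n P * (q ^ N ∸ 1) ≡ ∑[ c < q ^ k ] 𝟙 (allNonzero (λ l → dot (w l) (Coordinates.dec k c))) * q ^ (N ∸ k) * numGr n
  numDist-via-basis P hs 1≤i {k} B indB k≤N w gens≡ = begin
    numDist n P * (q ^ N ∸ 1)                  ≡⟨ cong (numDist n P *_) (sym numGr*[q∸1]≡q^N∸1) ⟩
    numDist n P * (numGr n * (q ∸ 1))          ≡⟨ rearrange (numDist n P) (numGr n) (q ∸ 1) ⟩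
    numDist n P * (q ∸ 1) * numGr n            ≡⟨ cong (_* numGr n) (trans (numDist*[q∸1] P hs 1≤i) counted) ⟩
    kernelSize * G * numGr n                   ≡⟨ cong (λ z → z * G * numGr n) (kernelSize≡q^[n∸k] k≤N) ⟩
    q ^ (N ∸ k) * G * numGr n                  ≡⟨ cong (_* numGr n) (ℕP.*-comm (q ^ (N ∸ k)) G) ⟩
    G * q ^ (N ∸ k) * numGr n                  ∎
    where
    open ≡-Reasoning
    open Kernel B indB
    rearrange : ∀ x y z → x * (y * z) ≡ x * z * y
    rearrange = solve-∀
    G = ∑[ c < q ^ k ] 𝟙 (allNonzero (λ l → dot (w l) (Coordinates.dec k c)))
    dot-in-basis : ∀ e l → dot (coord e) (generators P hs l) ≡ dot (w l) (Coordinates.dec k (valueCode e))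
    dot-in-basis e l = trans (dot-cong {a = coord e} (λ _ → refl) (gens≡ l))
      (trans (dot-combʳ B (w l) (coord e)) (dot-cong {a = w l} (λ _ → refl) (λ m → sym (Coordinates.dec-enc k (values (coord e)) m))))
    counted : ∑[ e < M ] 𝟙 (allNonzero (λ l → dot (coord e) (generators P hs l))) ≡ kernelSize * G
    counted = trans (sum-cong-≗ {M} (λ e → cong 𝟙 (allNonzero-cong (dot-in-basis e))))
                    (∑-via-values (λ c → 𝟙 (allNonzero (λ l → dot (w l) (Coordinates.dec k c)))))

  numDist-independent : ∀ (P : List (Subset M)) (hs : AllLines P) → 1 ≤ length P → length P ≤ N → HasDim (length P) (span P) →
    numDist n P * (q ^ N ∸ 1) ≡ (q ∸ 1) ^ length P * q ^ (N ∸ length P) * numGr n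
  numDist-independent P hs 1≤i i≤N h =
    trans (numDist-via-basis P hs 1≤i (generators P hs) (generators-independent P hs h) i≤N unitVec (λ l j → sym (comb-unitVec (generators P hs) l j)))
          (cong (λ z → z * q ^ (N ∸ length P) * numGr n)
                (trans (sum-cong-≗ (λ c → cong 𝟙 (allNonzero-cong (λ l → dot-unitVecˡ l (Coordinates.dec (length P) c)))))
                       (count-allNonzero (length P))))

  numDist-coplanar : ∀ (P : List (Subset M)) (hs : AllLines P) → Unique P → 1 ≤ length P → length P ≤ q → 2 ≤ N → HasDim 2 (span P) →
    numDist n P * (q ^ N ∸ 1) ≡ (q + 1 ∸ length P) * (q ∸ 1) * q ^ (N ∸ 2) * numGr n
  numDist-coplanar (L ∷ P) hs u 1≤i i≤q 2≤N h =
    trans (numDist-via-basis (L ∷ P) hs 1≤i basis independent 2≤N w gens≡)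
          (cong (λ z → z * q ^ (N ∸ 2) * numGr n) (count-allNonzero-plane (length P) w w≢0 distinct-independent i≤q))
    where
    open HasDim h
    gs = generators (L ∷ P) hs
    in-basis : ∀ l → Σ (𝔽^ 2) λ c → C.enc (gs l) ≡ C.enc (comb basis c)
    in-basis l = spans _ (generators∈span (L ∷ P) hs l)
    w : Fin (length (L ∷ P)) → 𝔽^ 2
    w l = proj₁ (in-basis l)
    gens≡ : ∀ l j → gs l j ≡ comb basis (w l) j
    gens≡ l j = trans (sym (C.dec-enc (gs l) j)) (trans (cong (λ z → coord z j) (proj₂ (in-basis l))) (C.dec-enc (comb basis (w l)) j))
    w≢0 : ∀ l → ¬ (∀ j → w l j ≡ 0#)
    w≢0 l w≡0 = generator≢0 (L ∷ P) hs l (λ j → trans (gens≡ l j) (trans (comb-cong basis w≡0 j) (comb-0 basis j)))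
    distinct-independent : ∀ l l' → l ≢ l' → Independent (pair (w l) (w l'))
    distinct-independent l l' l≢l' c c·w≡0 = distinct-generators-independent (L ∷ P) hs u l l' l≢l' c (λ j → begin
        comb (pair (gs l) (gs l')) c j                                    ≡⟨ comb-pair (gs l) (gs l') c j ⟩
        c zero *ᶠ gs l j +ᶠ c (suc zero) *ᶠ gs l' j                        ≡⟨ cong₂ (λ a b → c zero *ᶠ a +ᶠ c (suc zero) *ᶠ b) (gens≡ l j) (gens≡ l' j) ⟩
        c zero *ᶠ comb basis (w l) j +ᶠ c (suc zero) *ᶠ comb basis (w l') j ≡⟨ sym (comb-lin basis (c zero) (c (suc zero)) (w l) (w l') j) ⟩
        comb basis (λ m → c zero *ᶠ w l m +ᶠ c (suc zero) *ᶠ w l' m) j       ≡⟨ comb-cong basis (λ m → trans (sym (comb-pair (w l) (w l') c m)) (c·w≡0 m)) j ⟩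
        comb basis (λ _ → 0#) j                                            ≡⟨ comb-0 basis j ⟩
        0#                                                                 ∎)
      where open ≡-Reasoning

open import Data.Nat using (suc; _+_; _*_; _∸_; _^_; _≤_; s≤s; z≤n)
open import Data.Nat.Properties using (≤-trans; m≤n⇒m≤1+n)
open import Data.Bool using (T)
open import Data.List using (List; length)
open import Data.List.Relation.Unary.All using (All)
open import Data.List.Relation.Unary.Unique.Propositional using (Unique)
open import Data.Fin.Subset using (Subset)
open import Data.Product using (_×_; _,_)
open import Relation.Binary.PropositionalEquality using (_≡_)

proposition5p1 :
    (q : ℕ) (F : FiniteField q) → IsPrimePower q →
    (N : ℕ) → 3 ≤ N →
    (P : List (Subset (q ^ N))) →
    All (λ L → T (Geometry.hasDimᵇ F N 1 L)) P →
    Unique P →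
    2 ≤ length P →
    ((T (Geometry.hasDimᵇ F N 2 (Geometry.span F N P)) → length P ≤ q →
       Geometry.numDist F N (N ∸ 1) P * (q ^ N ∸ 1)
         ≡ (q + 1 ∸ length P) * (q ∸ 1) * q ^ (N ∸ 2) * Geometry.numGr F N (N ∸ 1))
     ×
     (length P ≤ N ∸ 1 → T (Geometry.hasDimᵇ F N (length P) (Geometry.span F N P)) →
       Geometry.numDist F N (N ∸ 1) P * (q ^ N ∸ 1)
         ≡ (q ∸ 1) ^ length P * q ^ (N ∸ length P) * Geometry.numGr F N (N ∸ 1)))
proposition5p1 q F _ (suc (suc (suc k))) (s≤s (s≤s (s≤s _))) P lines unique 2≤i =
    (λ span-dim-2 i≤q → numDist-coplanar P lines unique 1≤i i≤q (s≤s (s≤s z≤n)) (T-hasDim 2 _ span-dim-2))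
  , (λ i≤N∸1 span-dim-i → numDist-independent P lines 1≤i (m≤n⇒m≤1+n i≤N∸1) (T-hasDim (length P) _ span-dim-i))
  where
  open Hyperplanes F (suc (suc k))
  open Subspaces F N using (T-hasDim)
  1≤i : 1 ≤ length P
  1≤i = ≤-trans (s≤s z≤n) 2≤i
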